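{- Let $T_{\not\exists}$ be a set of $\exists$-free formulas and $A(x)$ a formula of $\mathcal{L}^\omega_*$ whose only free variable is $x$. If $$\mathrm{IL}^{\omega}_*+\mathrm{AC}^{\omega}_*+\mathrm{IP}^*_{\not\exists}+T_{\not\exists}\vdash\exists x\,A(x),$$ then there exist closed terms $t_1,\ldots,t_n$ such that $$\mathrm{IL}^{\omega}_*+\mathrm{AC}^{\omega}_*+\mathrm{IP}^*_{\not\exists}+T_{\not\exists}\vdash A(t_1)\lor\ldots\lor A(t_n).$$
   Context: Fix a first-order language $\mathcal{L}$ with at least one constant symbol. Types: $G$; $\sigma\to\tau$; $\sigma^*$. Constants: function symbols of $\mathcal{L}$; $\Pi_{\sigma,\tau}:\sigma\to\tau\to\sigma$; $\Sigma_{\rho,\sigma,\tau}:(\rho\to\sigma\to\tau)\to(\rho\to\sigma)\to\rho\to\tau$; $\mathfrak{s}_\sigma:\sigma\to\sigma^*$; $\cup_\sigma:\sigma^*\to\sigma^*\to\sigma^*$; $\bigcup_{\sigma,\tau}:\sigma^*\to(\sigma\to\tau^*)\to\tau^*$. Terms: constants, typed variables, applications. Atomic formulas: $\bot$, $t=_\rho q$, $t\in_\rho q$ ($q:\rho^*$), $R(t_1,\dots,t_n)$. Formulas of $\mathcal{L}^\omega_*$: closed under $\lor,\land,\to,\forall x,\exists x$ and bounded quantifiers $\forall x\in t,\exists x\in t$. A formula is $\exists$-free if it contains no unbounded $\exists x$. $\mathrm{IL}^{\omega}_*$ is intuitionistic predicate logic in all finite types with: $x=x$; $x=y\land A\to A'$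 ($A$ atomic); $\forall x\in t\,A\leftrightarrow\forall x(x\in t\to A)$; $\exists x\in t\,A\leftrightarrow\exists x(x\in t\land A)$; $\Sigma xyz=xz(yz)$; $\Pi xy=x$; $w\in\mathfrak{s}x\leftrightarrow w=x$; $w\in\cup xy\leftrightarrow w\in x\lor w\in y$; $z\in x\land w\in yz\to w\in\bigcup xy$; $\bigcup(\mathfrak{s}x)y=yx$; $\bigcup(\cup xy)z=\cup(\bigcup xz)(\bigcup yz)$. $\mathrm{AC}^{\omega}_*$: $\forall x^\rho\exists y^\sigma A(x,y)\to\exists f^{\rho\to\sigma^*}\forall x\exists y\in fx\,A(x,y)$. $\mathrm{IP}^*_{\not\exists}$: $(B(x)\to\exists y\,A(y))\to\exists w(B(x)\to\exists y\in w\,A(y))$ for $\exists$-free $B$. -}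

module Defs where

open import Data.Nat using (ℕ; zero; suc)
open import Data.List using (List; []; _∷_; map)
open import Data.List.Membership.Propositional using () renaming (_∈_ to _∈ᴸ_)
open import Data.Vec as Vec using (Vec; _∷_)
open import Relation.Binary.PropositionalEquality using (_≡_)

infixr 30 _⇒_
infix 40 _*
data Ty : Set where
  G   : Ty
  _⇒_ : Ty → Ty → Ty
  _*  : Ty → Ty

record Language : Set₁ where
  field
    FunSym   : Set
    funAr    : FunSym → ℕ
    RelSym   : Set
    relAr    : RelSym → ℕ
    c₀       : FunSym
    c₀-const : funAr c₀ ≡ 0

module Logic (𝓛 : Language) where
  open Language 𝓛

  funTy : ℕ → Ty
  funTy zero    = G
  funTy (suc n) = G ⇒ funTy n

  data Const : Ty → Set where
    fun    : (f : FunSym) → Const (funTy (funAr f))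
    Πc     : ∀ σ τ → Const (σ ⇒ τ ⇒ σ)
    Σc     : ∀ ρ σ τ → Const ((ρ ⇒ σ ⇒ τ) ⇒ (ρ ⇒ σ) ⇒ ρ ⇒ τ)
    sng    : ∀ σ → Const (σ ⇒ σ *)
    cup    : ∀ σ → Const (σ * ⇒ σ * ⇒ σ *)
    bigcup : ∀ σ τ → Const (σ * ⇒ (σ ⇒ τ *) ⇒ τ *)

  -- typed contexts (de Bruijn; head = most recently bound variable)
  Ctx : Set
  Ctx = List Ty

  data _∋_ : Ctx → Ty → Set where
    here  : ∀ {Γ σ} → (σ ∷ Γ) ∋ σ
    there : ∀ {Γ σ τ} → Γ ∋ σ → (τ ∷ Γ) ∋ σ

  infixl 40 _·_
  data Tm (Γ : Ctx) : Ty → Set where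
    var : ∀ {σ} → Γ ∋ σ → Tm Γ σ
    con : ∀ {σ} → Const σ → Tm Γ σ
    _·_ : ∀ {σ τ} → Tm Γ (σ ⇒ τ) → Tm Γ σ → Tm Γ τ

  infix  35 _≐_ _∈'_
  infixr 30 _∧'_
  infixr 29 _∨'_
  infixr 28 _⇒'_
  data Fm (Γ : Ctx) : Set where
    ⊥'   : Fm Γ
    _≐_  : ∀ {ρ} → Tm Γ ρ → Tm Γ ρ → Fm Γ
    _∈'_ : ∀ {ρ} → Tm Γ ρ → Tm Γ (ρ *) → Fm Γ
    rel  : (R : RelSym) → Vec (Tm Γ G) (relAr R) → Fm Γ
    _∨'_ _∧'_ _⇒'_ : Fm Γ → Fm Γ → Fm Γ
    ∀' ∃' : (σ : Ty) → Fm (σ ∷ Γ) → Fm Γ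
    ∀∈ ∃∈ : ∀ {σ} → Tm Γ (σ *) → Fm (σ ∷ Γ) → Fm Γ

  infix 27 _⇔'_
  _⇔'_ : ∀ {Γ} → Fm Γ → Fm Γ → Fm Γ
  A ⇔' B = (A ⇒' B) ∧' (B ⇒' A)

  Ren : Ctx → Ctx → Set
  Ren Γ Δ = ∀ {σ} → Γ ∋ σ → Δ ∋ σ

  liftR : ∀ {Γ Δ σ} → Ren Γ Δ → Ren (σ ∷ Γ) (σ ∷ Δ)
  liftR r here      = here
  liftR r (there x) = there (r x)

  renT : ∀ {Γ Δ σ} → Ren Γ Δ → Tm Γ σ → Tm Δ σ
  renT r (var x) = var (r x)
  renT r (con c) = con c
  renT r (t · u) = renT r t · renT r u

  renF : ∀ {Γ Δ} → Ren Γ Δ → Fm Γ → Fm Δ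
  renF r ⊥'         = ⊥'
  renF r (t ≐ u)    = renT r t ≐ renT r u
  renF r (t ∈' u)   = renT r t ∈' renT r u
  renF r (rel R ts) = rel R (Vec.map (renT r) ts)
  renF r (A ∨' B)   = renF r A ∨' renF r B
  renF r (A ∧' B)   = renF r A ∧' renF r B
  renF r (A ⇒' B)   = renF r A ⇒' renF r B
  renF r (∀' σ A)   = ∀' σ (renF (liftR r) A)
  renF r (∃' σ A)   = ∃' σ (renF (liftR r) A)
  renF r (∀∈ t A)   = ∀∈ (renT r t) (renF (liftR r) A)
  renF r (∃∈ t A)   = ∃∈ (renT r t) (renF (liftR r) A)

  wkT : ∀ {Γ σ τ} → Tm Γ τ → Tm (σ ∷ Γ) τ
  wkT = renT there

  wkF : ∀ {Γ σ} → Fm Γ → Fm (σ ∷ Γ)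
  wkF = renF there

  emptyR : ∀ {Γ} → Ren [] Γ
  emptyR ()

  Sub : Ctx → Ctx → Set
  Sub Γ Δ = ∀ {σ} → Γ ∋ σ → Tm Δ σ

  liftS : ∀ {Γ Δ σ} → Sub Γ Δ → Sub (σ ∷ Γ) (σ ∷ Δ)
  liftS s here      = var here
  liftS s (there x) = wkT (s x)

  subT : ∀ {Γ Δ σ} → Sub Γ Δ → Tm Γ σ → Tm Δ σ
  subT s (var x) = s x
  subT s (con c) = con c
  subT s (t · u) = subT s t · subT s u

  subF : ∀ {Γ Δ} → Sub Γ Δ → Fm Γ → Fm Δ
  subF s ⊥'         = ⊥'
  subF s (t ≐ u)    = subT s t ≐ subT s u
  subF s (t ∈' u)   = subT s t ∈' subT s u
  subF s (rel R ts) = rel R (Vec.map (subT s) ts)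
  subF s (A ∨' B)   = subF s A ∨' subF s B
  subF s (A ∧' B)   = subF s A ∧' subF s B
  subF s (A ⇒' B)   = subF s A ⇒' subF s B
  subF s (∀' σ A)   = ∀' σ (subF (liftS s) A)
  subF s (∃' σ A)   = ∃' σ (subF (liftS s) A)
  subF s (∀∈ t A)   = ∀∈ (subT s t) (subF (liftS s) A)
  subF s (∃∈ t A)   = ∃∈ (subT s t) (subF (liftS s) A)

  single : ∀ {Γ σ} → Tm Γ σ → Sub (σ ∷ Γ) Γ
  single t here      = t
  single t (there x) = var x

  infix 50 _[_]
  _[_] : ∀ {Γ σ} → Fm (σ ∷ Γ) → Tm Γ σ → Fm Γ
  A [ t ] = subF (single t) A

  data Atomic {Γ : Ctx} : Fm Γ → Set where
    at-⊥   : Atomic ⊥'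
    at-≐   : ∀ {ρ} (t u : Tm Γ ρ) → Atomic (t ≐ u)
    at-∈   : ∀ {ρ} (t : Tm Γ ρ) (u : Tm Γ (ρ *)) → Atomic (t ∈' u)
    at-rel : ∀ R ts → Atomic (rel R ts)

  data ExFree {Γ : Ctx} : Fm Γ → Set where
    ef-at : ∀ {A} → Atomic A → ExFree A
    ef-∨  : ∀ {A B} → ExFree A → ExFree B → ExFree (A ∨' B)
    ef-∧  : ∀ {A B} → ExFree A → ExFree B → ExFree (A ∧' B)
    ef-⇒  : ∀ {A B} → ExFree A → ExFree B → ExFree (A ⇒' B)
    ef-∀  : ∀ {σ A} → ExFree A → ExFree (∀' σ A)
    ef-∀∈ : ∀ {σ} {t : Tm Γ (σ *)} {A} → ExFree A → ExFree (∀∈ t A)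
    ef-∃∈ : ∀ {σ} {t : Tm Γ (σ *)} {A} → ExFree A → ExFree (∃∈ t A)

  -- non-logical axioms of IL^ω_* together with AC^ω_* and IP^*_∄
  -- (schemes instantiated at arbitrary terms of the current context)
  data Ax {Γ : Ctx} : Fm Γ → Set where
    eq-refl  : ∀ {ρ} (t : Tm Γ ρ) → Ax (t ≐ t)
    eq-subst : ∀ {ρ} (s t : Tm Γ ρ) (A : Fm (ρ ∷ Γ)) → Atomic A →
               Ax (s ≐ t ∧' A [ s ] ⇒' A [ t ])
    ∀∈-def   : ∀ {σ} (t : Tm Γ (σ *)) (A : Fm (σ ∷ Γ)) →
               Ax (∀∈ t A ⇔' ∀' σ (var here ∈' wkT t ⇒' A))
    ∃∈-def   : ∀ {σ} (t : Tm Γ (σ *)) (A : Fm (σ ∷ Γ)) →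
               Ax (∃∈ t A ⇔' ∃' σ (var here ∈' wkT t ∧' A))
    Σ-ax     : ∀ {ρ σ τ} (x : Tm Γ (ρ ⇒ σ ⇒ τ)) (y : Tm Γ (ρ ⇒ σ)) (z : Tm Γ ρ) →
               Ax (con (Σc ρ σ τ) · x · y · z ≐ x · z · (y · z))
    Π-ax     : ∀ {σ τ} (x : Tm Γ σ) (y : Tm Γ τ) → Ax (con (Πc σ τ) · x · y ≐ x)
    sng-ax   : ∀ {σ} (w x : Tm Γ σ) → Ax (w ∈' con (sng σ) · x ⇔' w ≐ x)
    cup-ax   : ∀ {σ} (w : Tm Γ σ) (x y : Tm Γ (σ *)) →
               Ax (w ∈' con (cup σ) · x · y ⇔' w ∈' x ∨' w ∈' y)
    bigcup-mem : ∀ {σ τ} (z : Tm Γ σ) (x : Tm Γ (σ *)) (w : Tm Γ τ) (y : Tm Γ (σ ⇒ τ *)) →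
               Ax (z ∈' x ∧' w ∈' y · z ⇒' w ∈' con (bigcup σ τ) · x · y)
    bigcup-sng : ∀ {σ τ} (x : Tm Γ σ) (y : Tm Γ (σ ⇒ τ *)) →
               Ax (con (bigcup σ τ) · (con (sng σ) · x) · y ≐ y · x)
    bigcup-cup : ∀ {σ τ} (x y : Tm Γ (σ *)) (z : Tm Γ (σ ⇒ τ *)) →
               Ax (con (bigcup σ τ) · (con (cup σ) · x · y) · z
                   ≐ con (cup τ) · (con (bigcup σ τ) · x · z) · (con (bigcup σ τ) · y · z))
    -- AC^ω_* : ∀x^ρ ∃y^σ A(x,y) → ∃f^{ρ→σ*} ∀x ∃y∈fx A(x,y)
    AC       : ∀ {ρ σ} (A : Fm (σ ∷ ρ ∷ Γ)) →
               Ax (∀' ρ (∃' σ A) ⇒'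
                   ∃' (ρ ⇒ σ *) (∀' ρ (∃∈ (var (there here) · var here)
                                          (renF (liftR (liftR there)) A))))
    -- IP^*_∄ : (B → ∃y A(y)) → ∃w (B → ∃y∈w A(y)),  B ∃-free
    IP       : ∀ {σ} (B : Fm Γ) (A : Fm (σ ∷ Γ)) → ExFree B →
               Ax ((B ⇒' ∃' σ A) ⇒' ∃' (σ *) (wkF B ⇒' ∃∈ (var here) (renF (liftR there) A)))

  -- Derivability in IL^ω_* + AC^ω_* + IP^*_∄ + T (intuitionistic natural deduction),
  -- T a set of sentences; Γ the typed variable context, Δ the open hypotheses.
  data Der (T : Fm [] → Set) : (Γ : Ctx) → List (Fm Γ) → Fm Γ → Set where
    hyp : ∀ {Γ Δ A} → A ∈ᴸ Δ → Der T Γ Δ A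
    ax  : ∀ {Γ Δ A} → Ax A → Der T Γ Δ A
    thy : ∀ {Γ Δ B} → T B → Der T Γ Δ (renF emptyR B)
    ⊥E  : ∀ {Γ Δ A} → Der T Γ Δ ⊥' → Der T Γ Δ A
    ∧I  : ∀ {Γ Δ A B} → Der T Γ Δ A → Der T Γ Δ B → Der T Γ Δ (A ∧' B)
    ∧E₁ : ∀ {Γ Δ A B} → Der T Γ Δ (A ∧' B) → Der T Γ Δ A
    ∧E₂ : ∀ {Γ Δ A B} → Der T Γ Δ (A ∧' B) → Der T Γ Δ B
    ∨I₁ : ∀ {Γ Δ A B} → Der T Γ Δ A → Der T Γ Δ (A ∨' B)
    ∨I₂ : ∀ {Γ Δ A B} → Der T Γ Δ B → Der T Γ Δ (A ∨' B)
    ∨E  : ∀ {Γ Δ A B C} → Der T Γ Δ (A ∨' B) → Der T Γ (A ∷ Δ) C →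
          Der T Γ (B ∷ Δ) C → Der T Γ Δ C
    ⇒I  : ∀ {Γ Δ A B} → Der T Γ (A ∷ Δ) B → Der T Γ Δ (A ⇒' B)
    ⇒E  : ∀ {Γ Δ A B} → Der T Γ Δ (A ⇒' B) → Der T Γ Δ A → Der T Γ Δ B
    ∀I  : ∀ {Γ Δ σ A} → Der T (σ ∷ Γ) (map wkF Δ) A → Der T Γ Δ (∀' σ A)
    ∀E  : ∀ {Γ Δ σ A} → Der T Γ Δ (∀' σ A) → (t : Tm Γ σ) → Der T Γ Δ (A [ t ])
    ∃I  : ∀ {Γ Δ σ A} (t : Tm Γ σ) → Der T Γ Δ (A [ t ]) → Der T Γ Δ (∃' σ A)
    ∃E  : ∀ {Γ Δ σ A C} → Der T Γ Δ (∃' σ A) →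
          Der T (σ ∷ Γ) (A ∷ map wkF Δ) (wkF C) → Der T Γ Δ C

  bigOr : ∀ {Γ n} → Vec (Fm Γ) (suc n) → Fm Γ
  bigOr (A ∷ Vec.[])    = A
  bigOr (A ∷ (B ∷ Bs))  = A ∨' bigOr (B ∷ Bs)

-- Herbrandized modified realizability with truth. Every formula A gets a tuple of realizer
-- types, each of the form ρ₁ → … → ρₖ → σ*, and a formula "a mr A": an existential ∃x B is
-- realized by a finite set w of candidate witnesses together with a realizer of B for all of
-- them (∃x∈w B), a disjunction by a pair of realizers without a choice bit, an implication
-- also asserts its own truth, and an ∃-free formula is realized by anything once it is true.
-- Realizers of set-valued type can be merged with ∪ and ⋃, and mr is monotone in the
-- realizer with respect to inclusion; this makes ∨-elimination and ∃-elimination sound, and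
-- AC and IP for ∃-free premises are realized outright. By soundness, a proof of ∃x A yields a
-- closed w : σ* with ∃x∈w A provable. A Tait-style reducibility argument shows that every
-- closed term w : σ* is provably equal to a finite union {t₁} ∪ … ∪ {tₙ} of singletons, and
-- ∃x∈{t₁,…,tₙ} A unfolds to A(t₁) ∨ … ∨ A(tₙ).

module Submission where

open import Defs
open import Data.Nat using (ℕ; suc)
open import Data.List using ([]; _∷_)
open import Data.Vec using (Vec; map)
open import Data.Product using (Σ; ∃)
open import Data.Nat using (zero; _+_)
open import Data.Fin using (zero; suc)
open import Data.List using (List) renaming (map to lmap)
open import Data.List.Membership.Propositional using (_∈_)
open import Data.List.Membership.Propositional.Properties using (∈-map⁺; ∈-map⁻)
open import Data.List.Relation.Unary.Any using (here; there)
open import Data.List.Relation.Binary.Subset.Propositional using (_⊆_)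
open import Data.List.Relation.Binary.Subset.Propositional.Properties using (∷⁺ʳ; map⁺)
open import Data.Unit using (⊤; tt)
open import Data.Vec as Vec using (_∷_; _[_]≔_)
open import Data.Vec.Properties using (map-cong; map-∘; map-id; lookup-map; map-++; map-[]≔; []≔-lookup)
open import Data.Product using (_,_; proj₁; proj₂; _×_)
open import Relation.Binary.PropositionalEquality hiding ([_])
open import Function using (_∘_)

module Substitution (𝓛 : Language) where
  open Logic 𝓛

  infixr 9 _⊙_
  _⊙_ : ∀ {Γ Δ Θ} → Sub Δ Θ → Sub Γ Δ → Sub Γ Θ
  (s ⊙ r) x = subT s (r x)

  renSub : ∀ {Γ Δ} → Ren Γ Δ → Sub Γ Δ
  renSub r x = var (r x)

  infix 4 _≗s_
  _≗s_ : ∀ {Γ Δ} → Sub Γ Δ → Sub Γ Δ → Set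
  s ≗s s' = ∀ {σ} (x : _ ∋ σ) → s x ≡ s' x

  liftS-cong : ∀ {Γ Δ τ} {s s' : Sub Γ Δ} → s ≗s s' → liftS {σ = τ} s ≗s liftS s'
  liftS-cong e here      = refl
  liftS-cong e (there x) = cong wkT (e x)

  subT-cong : ∀ {Γ Δ σ} {s s' : Sub Γ Δ} → s ≗s s' → (t : Tm Γ σ) → subT s t ≡ subT s' t
  subT-cong e (var x) = e x
  subT-cong e (con c) = refl
  subT-cong e (t · u) = cong₂ _·_ (subT-cong e t) (subT-cong e u)

  subF-cong : ∀ {Γ Δ} {s s' : Sub Γ Δ} → s ≗s s' → (A : Fm Γ) → subF s A ≡ subF s' A
  subF-cong e ⊥'         = refl
  subF-cong e (t ≐ u)    = cong₂ _≐_ (subT-cong e t) (subT-cong e u)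
  subF-cong e (t ∈' u)   = cong₂ _∈'_ (subT-cong e t) (subT-cong e u)
  subF-cong e (rel R ts) = cong (rel R) (map-cong (subT-cong e) ts)
  subF-cong e (A ∨' B)   = cong₂ _∨'_ (subF-cong e A) (subF-cong e B)
  subF-cong e (A ∧' B)   = cong₂ _∧'_ (subF-cong e A) (subF-cong e B)
  subF-cong e (A ⇒' B)   = cong₂ _⇒'_ (subF-cong e A) (subF-cong e B)
  subF-cong e (∀' σ A)   = cong (∀' σ) (subF-cong (liftS-cong e) A)
  subF-cong e (∃' σ A)   = cong (∃' σ) (subF-cong (liftS-cong e) A)
  subF-cong e (∀∈ t A)   = cong₂ ∀∈ (subT-cong e t) (subF-cong (liftS-cong e) A)
  subF-cong e (∃∈ t A)   = cong₂ ∃∈ (subT-cong e t) (subF-cong (liftS-cong e) A)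

  renT≡subT : ∀ {Γ Δ σ} (r : Ren Γ Δ) (t : Tm Γ σ) → renT r t ≡ subT (renSub r) t
  renT≡subT r (var x) = refl
  renT≡subT r (con c) = refl
  renT≡subT r (t · u) = cong₂ _·_ (renT≡subT r t) (renT≡subT r u)

  liftR≗liftS : ∀ {Γ Δ τ} (r : Ren Γ Δ) → renSub (liftR {σ = τ} r) ≗s liftS (renSub r)
  liftR≗liftS r here      = refl
  liftR≗liftS r (there x) = refl

  renF≡subF-lift : ∀ {Γ Δ τ} (r : Ren Γ Δ) (A : Fm (τ ∷ Γ)) → renF (liftR r) A ≡ subF (liftS (renSub r)) A
  renF≡subF : ∀ {Γ Δ} (r : Ren Γ Δ) (A : Fm Γ) → renF r A ≡ subF (renSub r) A
  renF≡subF r ⊥'         = refl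
  renF≡subF r (t ≐ u)    = cong₂ _≐_ (renT≡subT r t) (renT≡subT r u)
  renF≡subF r (t ∈' u)   = cong₂ _∈'_ (renT≡subT r t) (renT≡subT r u)
  renF≡subF r (rel R ts) = cong (rel R) (map-cong (renT≡subT r) ts)
  renF≡subF r (A ∨' B)   = cong₂ _∨'_ (renF≡subF r A) (renF≡subF r B)
  renF≡subF r (A ∧' B)   = cong₂ _∧'_ (renF≡subF r A) (renF≡subF r B)
  renF≡subF r (A ⇒' B)   = cong₂ _⇒'_ (renF≡subF r A) (renF≡subF r B)
  renF≡subF r (∀' σ A)   = cong (∀' σ) (renF≡subF-lift r A)
  renF≡subF r (∃' σ A)   = cong (∃' σ) (renF≡subF-lift r A)
  renF≡subF r (∀∈ t A)   = cong₂ ∀∈ (renT≡subT r t) (renF≡subF-lift r A)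
  renF≡subF r (∃∈ t A)   = cong₂ ∃∈ (renT≡subT r t) (renF≡subF-lift r A)

  renF≡subF-lift r A = trans (renF≡subF (liftR r) A) (subF-cong (liftR≗liftS r) A)

  subT-renT : ∀ {Γ Δ Θ σ} (s : Sub Δ Θ) (r : Ren Γ Δ) (t : Tm Γ σ) → subT s (renT r t) ≡ subT (s ∘ r) t
  subT-renT s r (var x) = refl
  subT-renT s r (con c) = refl
  subT-renT s r (t · u) = cong₂ _·_ (subT-renT s r t) (subT-renT s r u)

  renT-renT : ∀ {Γ Δ Θ σ} (s : Ren Δ Θ) (r : Ren Γ Δ) (t : Tm Γ σ) → renT s (renT r t) ≡ renT (s ∘ r) t
  renT-renT s r (var x) = refl
  renT-renT s r (con c) = refl
  renT-renT s r (t · u) = cong₂ _·_ (renT-renT s r t) (renT-renT s r u)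

  renT-subT : ∀ {Γ Δ Θ σ} (r : Ren Δ Θ) (s : Sub Γ Δ) (t : Tm Γ σ) → renT r (subT s t) ≡ subT (renT r ∘ s) t
  renT-subT r s (var x) = refl
  renT-subT r s (con c) = refl
  renT-subT r s (t · u) = cong₂ _·_ (renT-subT r s t) (renT-subT r s u)

  subT-liftS-wkT : ∀ {Γ Δ τ σ} (s : Sub Γ Δ) (t : Tm Γ σ) → subT (liftS {σ = τ} s) (wkT t) ≡ wkT (subT s t)
  subT-liftS-wkT s t = trans (subT-renT (liftS s) there t) (sym (renT-subT there s t))

  liftS-⊙ : ∀ {Γ Δ Θ τ} (s : Sub Δ Θ) (s' : Sub Γ Δ) → liftS {σ = τ} s ⊙ liftS s' ≗s liftS (s ⊙ s')
  liftS-⊙ s s' here      = refl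
  liftS-⊙ s s' (there x) = subT-liftS-wkT s (s' x)

  subT-subT : ∀ {Γ Δ Θ σ} (s : Sub Δ Θ) (s' : Sub Γ Δ) (t : Tm Γ σ) → subT s (subT s' t) ≡ subT (s ⊙ s') t
  subT-subT s s' (var x) = refl
  subT-subT s s' (con c) = refl
  subT-subT s s' (t · u) = cong₂ _·_ (subT-subT s s' t) (subT-subT s s' u)

  subF-subF-lift : ∀ {Γ Δ Θ τ} (s : Sub Δ Θ) (s' : Sub Γ Δ) (A : Fm (τ ∷ Γ)) →
                   subF (liftS s) (subF (liftS s') A) ≡ subF (liftS (s ⊙ s')) A
  subF-subF : ∀ {Γ Δ Θ} (s : Sub Δ Θ) (s' : Sub Γ Δ) (A : Fm Γ) → subF s (subF s' A) ≡ subF (s ⊙ s') A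
  subF-subF s s' ⊥'         = refl
  subF-subF s s' (t ≐ u)    = cong₂ _≐_ (subT-subT s s' t) (subT-subT s s' u)
  subF-subF s s' (t ∈' u)   = cong₂ _∈'_ (subT-subT s s' t) (subT-subT s s' u)
  subF-subF s s' (rel R ts) = cong (rel R) (trans (sym (map-∘ _ _ ts)) (map-cong (subT-subT s s') ts))
  subF-subF s s' (A ∨' B)   = cong₂ _∨'_ (subF-subF s s' A) (subF-subF s s' B)
  subF-subF s s' (A ∧' B)   = cong₂ _∧'_ (subF-subF s s' A) (subF-subF s s' B)
  subF-subF s s' (A ⇒' B)   = cong₂ _⇒'_ (subF-subF s s' A) (subF-subF s s' B)
  subF-subF s s' (∀' σ A)   = cong (∀' σ) (subF-subF-lift s s' A)
  subF-subF s s' (∃' σ A)   = cong (∃' σ) (subF-subF-lift s s' A)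
  subF-subF s s' (∀∈ t A)   = cong₂ ∀∈ (subT-subT s s' t) (subF-subF-lift s s' A)
  subF-subF s s' (∃∈ t A)   = cong₂ ∃∈ (subT-subT s s' t) (subF-subF-lift s s' A)

  subF-subF-lift s s' A = trans (subF-subF (liftS s) (liftS s') A) (subF-cong (liftS-⊙ s s') A)

  liftS-var : ∀ {Γ τ} → liftS {σ = τ} (var {Γ}) ≗s var
  liftS-var here      = refl
  liftS-var (there x) = refl

  subT-id : ∀ {Γ σ} (t : Tm Γ σ) → subT var t ≡ t
  subT-id (var x) = refl
  subT-id (con c) = refl
  subT-id (t · u) = cong₂ _·_ (subT-id t) (subT-id u)

  subF-liftS-var : ∀ {Γ τ} (A : Fm (τ ∷ Γ)) → subF (liftS var) A ≡ A
  subF-id : ∀ {Γ} (A : Fm Γ) → subF var A ≡ A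
  subF-id ⊥'         = refl
  subF-id (t ≐ u)    = cong₂ _≐_ (subT-id t) (subT-id u)
  subF-id (t ∈' u)   = cong₂ _∈'_ (subT-id t) (subT-id u)
  subF-id (rel R ts) = cong (rel R) (trans (map-cong subT-id ts) (map-id ts))
  subF-id (A ∨' B)   = cong₂ _∨'_ (subF-id A) (subF-id B)
  subF-id (A ∧' B)   = cong₂ _∧'_ (subF-id A) (subF-id B)
  subF-id (A ⇒' B)   = cong₂ _⇒'_ (subF-id A) (subF-id B)
  subF-id (∀' σ A)   = cong (∀' σ) (subF-liftS-var A)
  subF-id (∃' σ A)   = cong (∃' σ) (subF-liftS-var A)
  subF-id (∀∈ t A)   = cong₂ ∀∈ (subT-id t) (subF-liftS-var A)
  subF-id (∃∈ t A)   = cong₂ ∃∈ (subT-id t) (subF-liftS-var A)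

  subF-liftS-var A = trans (subF-cong liftS-var A) (subF-id A)

  subT-single-wkT : ∀ {Γ σ τ} (u : Tm Γ τ) (t : Tm Γ σ) → subT (single u) (wkT t) ≡ t
  subT-single-wkT u t = trans (subT-renT (single u) there t) (subT-id t)

  wkF≡subF : ∀ {Γ τ} (A : Fm Γ) → wkF {σ = τ} A ≡ subF (renSub there) A
  wkF≡subF = renF≡subF there

  subF-renF : ∀ {Γ Γ' Δ} (r : Ren Γ Γ') (s : Sub Γ' Δ) (A : Fm Γ) → subF s (renF r A) ≡ subF (s ∘ r) A
  subF-renF r s A = trans (cong (subF s) (renF≡subF r A)) (subF-subF s (renSub r) A)

  subF²-cong : ∀ {Γ Δ Δ' Θ} (s₁ : Sub Δ Θ) (s₁' : Sub Γ Δ) (s₂ : Sub Δ' Θ) (s₂' : Sub Γ Δ') →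
               s₁ ⊙ s₁' ≗s s₂ ⊙ s₂' → (A : Fm Γ) → subF s₁ (subF s₁' A) ≡ subF s₂ (subF s₂' A)
  subF²-cong s₁ s₁' s₂ s₂' e A = trans (subF-subF s₁ s₁' A) (trans (subF-cong e A) (sym (subF-subF s₂ s₂' A)))

  subF-[] : ∀ {Γ Δ σ} (s : Sub Γ Δ) (A : Fm (σ ∷ Γ)) (t : Tm Γ σ) →
            subF s (A [ t ]) ≡ subF (liftS s) A [ subT s t ]
  subF-[] s A t = subF²-cong s (single t) (single (subT s t)) (liftS s) pointwise A
    where
      pointwise : s ⊙ single t ≗s single (subT s t) ⊙ liftS s
      pointwise here      = refl
      pointwise (there x) = sym (subT-single-wkT (subT s t) (s x))

  Square : ∀ {Γ Γ' Δ Δ'} → Ren Γ Γ' → Sub Γ Δ → Sub Γ' Δ' → Ren Δ Δ' → Set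
  Square r s s' r' = ∀ {σ} (x : _ ∋ σ) → s' (r x) ≡ renT r' (s x)

  there-Square : ∀ {Γ Δ τ} (s : Sub Γ Δ) → Square there s (liftS {σ = τ} s) there
  there-Square s x = refl

  liftR-Square : ∀ {Γ Γ' Δ Δ' τ} {r : Ren Γ Γ'} {s : Sub Γ Δ} {s' : Sub Γ' Δ'} {r' : Ren Δ Δ'} →
                 Square r s s' r' → Square (liftR {σ = τ} r) (liftS s) (liftS s') (liftR r')
  liftR-Square e here = refl
  liftR-Square {s = s} {r' = r'} e (there x) =
    trans (cong wkT (e x)) (trans (renT-renT there r' (s x)) (sym (renT-renT (liftR r') there (s x))))

  subF-renF-Square : ∀ {Γ Γ' Δ Δ'} {r : Ren Γ Γ'} {s : Sub Γ Δ} {s' : Sub Γ' Δ'} {r' : Ren Δ Δ'} →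
                     Square r s s' r' → (A : Fm Γ) → subF s' (renF r A) ≡ renF r' (subF s A)
  subF-renF-Square {r = r} {s} {s'} {r'} e A =
    trans (cong (subF s') (renF≡subF r A))
      (trans (subF²-cong s' (renSub r) (renSub r') s (λ x → trans (e x) (renT≡subT r' (s _))) A)
        (sym (renF≡subF r' (subF s A))))

  subF-liftS-wkF : ∀ {Γ Δ τ} (s : Sub Γ Δ) (A : Fm Γ) → subF (liftS {σ = τ} s) (wkF A) ≡ wkF (subF s A)
  subF-liftS-wkF s = subF-renF-Square (there-Square s)

  subF-renF-liftR-there : ∀ {Γ Δ σ τ} (s : Sub Γ Δ) (A : Fm (σ ∷ Γ)) →
                          subF (liftS (liftS s)) (renF (liftR (there {τ = τ})) A) ≡ renF (liftR there) (subF (liftS s) A)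
  subF-renF-liftR-there s = subF-renF-Square (liftR-Square (there-Square s))

  subF-renF-liftR²-there : ∀ {Γ Δ σ ρ τ} (s : Sub Γ Δ) (A : Fm (σ ∷ ρ ∷ Γ)) →
                           subF (liftS (liftS (liftS s))) (renF (liftR (liftR (there {τ = τ}))) A)
                           ≡ renF (liftR (liftR there)) (subF (liftS (liftS s)) A)
  subF-renF-liftR²-there s = subF-renF-Square (liftR-Square (liftR-Square (there-Square s)))

  subF-closed : ∀ {Γ Δ} (s : Sub Γ Δ) (B : Fm []) → subF s (renF emptyR B) ≡ renF emptyR B
  subF-closed s B = trans (cong (subF s) (renF≡subF emptyR B))
    (trans (subF²-cong s (renSub emptyR) var (renSub emptyR) (λ ()) B)
      (trans (subF-id _) (sym (renF≡subF emptyR B))))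

  Atomic-subF : ∀ {Γ Δ} (s : Sub Γ Δ) {A : Fm Γ} → Atomic A → Atomic (subF s A)
  Atomic-subF s at-⊥          = at-⊥
  Atomic-subF s (at-≐ t u)    = at-≐ _ _
  Atomic-subF s (at-∈ t u)    = at-∈ _ _
  Atomic-subF s (at-rel R ts) = at-rel R _

  ExFree-subF : ∀ {Γ Δ} (s : Sub Γ Δ) {A : Fm Γ} → ExFree A → ExFree (subF s A)
  ExFree-subF s (ef-at a)  = ef-at (Atomic-subF s a)
  ExFree-subF s (ef-∨ a b) = ef-∨ (ExFree-subF s a) (ExFree-subF s b)
  ExFree-subF s (ef-∧ a b) = ef-∧ (ExFree-subF s a) (ExFree-subF s b)
  ExFree-subF s (ef-⇒ a b) = ef-⇒ (ExFree-subF s a) (ExFree-subF s b)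
  ExFree-subF s (ef-∀ a)   = ef-∀ (ExFree-subF (liftS s) a)
  ExFree-subF s (ef-∀∈ a)  = ef-∀∈ (ExFree-subF (liftS s) a)
  ExFree-subF s (ef-∃∈ a)  = ef-∃∈ (ExFree-subF (liftS s) a)

  Ax-subF : ∀ {Γ Δ} (s : Sub Γ Δ) {A : Fm Γ} → Ax A → Ax (subF s A)
  Ax-subF s (eq-refl t) = eq-refl _
  Ax-subF s (eq-subst u t A at)
    rewrite subF-[] s A u | subF-[] s A t = eq-subst _ _ _ (Atomic-subF (liftS s) at)
  Ax-subF s (∀∈-def {σ = σ} t A) rewrite subT-liftS-wkT {τ = σ} s t = ∀∈-def _ _
  Ax-subF s (∃∈-def {σ = σ} t A) rewrite subT-liftS-wkT {τ = σ} s t = ∃∈-def _ _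
  Ax-subF s (Σ-ax x y z)         = Σ-ax _ _ _
  Ax-subF s (Π-ax x y)           = Π-ax _ _
  Ax-subF s (sng-ax w x)         = sng-ax _ _
  Ax-subF s (cup-ax w x y)       = cup-ax _ _ _
  Ax-subF s (bigcup-mem z x w y) = bigcup-mem _ _ _ _
  Ax-subF s (bigcup-sng x y)     = bigcup-sng _ _
  Ax-subF s (bigcup-cup x y z)   = bigcup-cup _ _ _
  Ax-subF s (AC {ρ = ρ} {σ = σ} A) rewrite subF-renF-liftR²-there {τ = ρ ⇒ σ *} s A = AC _
  Ax-subF s (IP {σ = σ} B A ef)
    rewrite subF-liftS-wkF {τ = σ *} s B | subF-renF-liftR-there {τ = σ *} s A = IP _ _ (ExFree-subF s ef)

module Realizability (𝓛 : Language) (T : Logic.Fm 𝓛 [] → Set) where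
  open Logic 𝓛
  open Language 𝓛
  open Substitution 𝓛

  infix 3 _⨾_⊢_
  _⨾_⊢_ : (Γ : Ctx) → List (Fm Γ) → Fm Γ → Set
  Γ ⨾ Δ ⊢ A = Der T Γ Δ A

  hyp₀ : ∀ {Γ Δ A} → Γ ⨾ A ∷ Δ ⊢ A
  hyp₀ = hyp (here refl)

  hyp₁ : ∀ {Γ Δ A B} → Γ ⨾ B ∷ A ∷ Δ ⊢ A
  hyp₁ = hyp (there (here refl))

  cast : ∀ {Γ Δ A B} → A ≡ B → Γ ⨾ Δ ⊢ A → Γ ⨾ Δ ⊢ B
  cast = subst (_ ⨾ _ ⊢_)

  ⊢-⊆ : ∀ {Γ Δ Δ' A} → Γ ⨾ Δ ⊢ A → Δ ⊆ Δ' → Γ ⨾ Δ' ⊢ A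
  ⊢-⊆ (hyp p)    h = hyp (h p)
  ⊢-⊆ (ax a)     h = ax a
  ⊢-⊆ (thy b)    h = thy b
  ⊢-⊆ (⊥E d)     h = ⊥E (⊢-⊆ d h)
  ⊢-⊆ (∧I d e)   h = ∧I (⊢-⊆ d h) (⊢-⊆ e h)
  ⊢-⊆ (∧E₁ d)    h = ∧E₁ (⊢-⊆ d h)
  ⊢-⊆ (∧E₂ d)    h = ∧E₂ (⊢-⊆ d h)
  ⊢-⊆ (∨I₁ d)    h = ∨I₁ (⊢-⊆ d h)
  ⊢-⊆ (∨I₂ d)    h = ∨I₂ (⊢-⊆ d h)
  ⊢-⊆ (∨E d e f) h = ∨E (⊢-⊆ d h) (⊢-⊆ e (∷⁺ʳ _ h)) (⊢-⊆ f (∷⁺ʳ _ h))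
  ⊢-⊆ (⇒I d)     h = ⇒I (⊢-⊆ d (∷⁺ʳ _ h))
  ⊢-⊆ (⇒E d e)   h = ⇒E (⊢-⊆ d h) (⊢-⊆ e h)
  ⊢-⊆ (∀I d)     h = ∀I (⊢-⊆ d (map⁺ wkF h))
  ⊢-⊆ (∀E d t)   h = ∀E (⊢-⊆ d h) t
  ⊢-⊆ (∃I t d)   h = ∃I t (⊢-⊆ d h)
  ⊢-⊆ (∃E d e)   h = ∃E (⊢-⊆ d h) (⊢-⊆ e (∷⁺ʳ _ (map⁺ wkF h)))

  ⊢-wk₁ : ∀ {Γ Δ A B} → Γ ⨾ Δ ⊢ A → Γ ⨾ B ∷ Δ ⊢ A
  ⊢-wk₁ d = ⊢-⊆ d there

  RenHyps : ∀ {Γ Γ'} → Ren Γ Γ' → List (Fm Γ) → List (Fm Γ') → Set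
  RenHyps r Δ Δ' = ∀ {X} → X ∈ Δ → subF (renSub r) X ∈ Δ'

  RenHyps-∷ : ∀ {Γ Γ' Δ Δ' A B} {r : Ren Γ Γ'} → subF (renSub r) A ≡ B → RenHyps r Δ Δ' → RenHyps r (A ∷ Δ) (B ∷ Δ')
  RenHyps-∷ e h (here refl) = here e
  RenHyps-∷ e h (there p)   = there (h p)

  RenHyps-wkF : ∀ {Γ Γ' Δ Δ' τ} {r : Ren Γ Γ'} → RenHyps r Δ Δ' → RenHyps (liftR {σ = τ} r) (lmap wkF Δ) (lmap wkF Δ')
  RenHyps-wkF {Δ' = Δ'} {r = r} h p with ∈-map⁻ wkF p
  ... | X , q , refl = subst (_∈ lmap wkF Δ') (sym commute) (∈-map⁺ wkF (h q))
    where
      commute : subF (renSub (liftR r)) (wkF X) ≡ wkF (subF (renSub r) X)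
      commute = trans (subF-cong (liftR≗liftS r) (wkF X)) (subF-liftS-wkF (renSub r) X)

  ⊢-ren : ∀ {Γ Γ' Δ Δ' A} → Γ ⨾ Δ ⊢ A → (r : Ren Γ Γ') → RenHyps r Δ Δ' → Γ' ⨾ Δ' ⊢ subF (renSub r) A
  ⊢-ren (hyp p)         r h = hyp (h p)
  ⊢-ren (ax a)          r h = ax (Ax-subF (renSub r) a)
  ⊢-ren (thy {B = B} b) r h = cast (sym (subF-closed (renSub r) B)) (thy b)
  ⊢-ren (⊥E d)          r h = ⊥E (⊢-ren d r h)
  ⊢-ren (∧I d e)        r h = ∧I (⊢-ren d r h) (⊢-ren e r h)
  ⊢-ren (∧E₁ d)         r h = ∧E₁ (⊢-ren d r h)
  ⊢-ren (∧E₂ d)         r h = ∧E₂ (⊢-ren d r h)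
  ⊢-ren (∨I₁ d)         r h = ∨I₁ (⊢-ren d r h)
  ⊢-ren (∨I₂ d)         r h = ∨I₂ (⊢-ren d r h)
  ⊢-ren (∨E d e f)      r h = ∨E (⊢-ren d r h) (⊢-ren e r (RenHyps-∷ refl h)) (⊢-ren f r (RenHyps-∷ refl h))
  ⊢-ren (⇒I d)          r h = ⇒I (⊢-ren d r (RenHyps-∷ refl h))
  ⊢-ren (⇒E d e)        r h = ⇒E (⊢-ren d r h) (⊢-ren e r h)
  ⊢-ren (∀I {A = A} d)  r h = ∀I (cast (subF-cong (liftR≗liftS r) A) (⊢-ren d (liftR r) (RenHyps-wkF h)))
  ⊢-ren (∀E {A = A} d t) r h = cast (sym (subF-[] (renSub r) A t)) (∀E (⊢-ren d r h) (subT (renSub r) t))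
  ⊢-ren (∃I {A = A} t d) r h = ∃I (subT (renSub r) t) (cast (subF-[] (renSub r) A t) (⊢-ren d r h))
  ⊢-ren (∃E {A = A} {C = C} d e) r h =
    ∃E (⊢-ren d r h)
       (cast (trans (subF-cong (liftR≗liftS r) (wkF C)) (subF-liftS-wkF (renSub r) C))
             (⊢-ren e (liftR r) (RenHyps-∷ (subF-cong (liftR≗liftS r) A) (RenHyps-wkF h))))

  ⊢-wk : ∀ {Γ Δ A τ} → Γ ⨾ Δ ⊢ A → τ ∷ Γ ⨾ lmap wkF Δ ⊢ wkF A
  ⊢-wk {A = A} d = cast (sym (wkF≡subF A)) (⊢-ren d there (λ {X} p → subst (_∈ _) (wkF≡subF X) (∈-map⁺ wkF p)))

  SubHyps : ∀ {Γ Γ'} → Sub Γ Γ' → List (Fm Γ) → List (Fm Γ') → Set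
  SubHyps {Γ' = Γ'} s Δ Δ' = ∀ {X} → X ∈ Δ → Γ' ⨾ Δ' ⊢ subF s X

  SubHyps-∷ : ∀ {Γ Γ' Δ Δ' A} {s : Sub Γ Γ'} → SubHyps s Δ Δ' → SubHyps s (A ∷ Δ) (subF s A ∷ Δ')
  SubHyps-∷ h (here refl) = hyp₀
  SubHyps-∷ h (there p)   = ⊢-wk₁ (h p)

  SubHyps-wkF : ∀ {Γ Γ' Δ Δ' τ} {s : Sub Γ Γ'} → SubHyps s Δ Δ' → SubHyps (liftS {σ = τ} s) (lmap wkF Δ) (lmap wkF Δ')
  SubHyps-wkF {s = s} h p with ∈-map⁻ wkF p
  ... | X , q , refl = cast (sym (subF-liftS-wkF s X)) (⊢-wk (h q))

  ⊢-sub : ∀ {Γ Γ' Δ Δ' A} → Γ ⨾ Δ ⊢ A → (s : Sub Γ Γ') → SubHyps s Δ Δ' → Γ' ⨾ Δ' ⊢ subF s A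
  ⊢-sub (hyp p)          s h = h p
  ⊢-sub (ax a)           s h = ax (Ax-subF s a)
  ⊢-sub (thy {B = B} b)  s h = cast (sym (subF-closed s B)) (thy b)
  ⊢-sub (⊥E d)           s h = ⊥E (⊢-sub d s h)
  ⊢-sub (∧I d e)         s h = ∧I (⊢-sub d s h) (⊢-sub e s h)
  ⊢-sub (∧E₁ d)          s h = ∧E₁ (⊢-sub d s h)
  ⊢-sub (∧E₂ d)          s h = ∧E₂ (⊢-sub d s h)
  ⊢-sub (∨I₁ d)          s h = ∨I₁ (⊢-sub d s h)
  ⊢-sub (∨I₂ d)          s h = ∨I₂ (⊢-sub d s h)
  ⊢-sub (∨E d e f)       s h = ∨E (⊢-sub d s h) (⊢-sub e s (SubHyps-∷ h)) (⊢-sub f s (SubHyps-∷ h))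
  ⊢-sub (⇒I d)           s h = ⇒I (⊢-sub d s (SubHyps-∷ h))
  ⊢-sub (⇒E d e)         s h = ⇒E (⊢-sub d s h) (⊢-sub e s h)
  ⊢-sub (∀I d)           s h = ∀I (⊢-sub d (liftS s) (SubHyps-wkF h))
  ⊢-sub (∀E {A = A} d t) s h = cast (sym (subF-[] s A t)) (∀E (⊢-sub d s h) (subT s t))
  ⊢-sub (∃I {A = A} t d) s h = ∃I (subT s t) (cast (subF-[] s A t) (⊢-sub d s h))
  ⊢-sub (∃E {C = C} d e) s h = ∃E (⊢-sub d s h) (cast (subF-liftS-wkF s C) (⊢-sub e (liftS s) (SubHyps-∷ (SubHyps-wkF h))))

  ≐-subst-atomic : ∀ {Γ Δ ρ} (A : Fm (ρ ∷ Γ)) → Atomic A → {s t : Tm Γ ρ} {X Y : Fm Γ} →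
                   A [ s ] ≡ X → A [ t ] ≡ Y → Γ ⨾ Δ ⊢ s ≐ t → Γ ⨾ Δ ⊢ X → Γ ⨾ Δ ⊢ Y
  ≐-subst-atomic A at {s} {t} refl refl e d = ⇒E (ax (eq-subst s t A at)) (∧I e d)

  ≐-refl : ∀ {Γ Δ ρ} (a : Tm Γ ρ) → Γ ⨾ Δ ⊢ a ≐ a
  ≐-refl a = ax (eq-refl a)

  ≐-sym : ∀ {Γ Δ ρ} {a b : Tm Γ ρ} → Γ ⨾ Δ ⊢ a ≐ b → Γ ⨾ Δ ⊢ b ≐ a
  ≐-sym {a = a} {b} e = ≐-subst-atomic (var here ≐ wkT a) (at-≐ _ _)
    (cong (a ≐_) (subT-single-wkT a a)) (cong (b ≐_) (subT-single-wkT b a)) e (≐-refl a)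

  ≐-trans : ∀ {Γ Δ ρ} {a b c : Tm Γ ρ} → Γ ⨾ Δ ⊢ a ≐ b → Γ ⨾ Δ ⊢ b ≐ c → Γ ⨾ Δ ⊢ a ≐ c
  ≐-trans {a = a} {b} {c} e₁ e₂ = ≐-subst-atomic (wkT a ≐ var here) (at-≐ _ _)
    (cong (_≐ b) (subT-single-wkT b a)) (cong (_≐ c) (subT-single-wkT c a)) e₂ e₁

  ·-congʳ : ∀ {Γ Δ σ τ} (f : Tm Γ (σ ⇒ τ)) {u u' : Tm Γ σ} → Γ ⨾ Δ ⊢ u ≐ u' → Γ ⨾ Δ ⊢ f · u ≐ f · u'
  ·-congʳ f {u} {u'} e = ≐-subst-atomic (wkT (f · u) ≐ wkT f · var here) (at-≐ _ _)
    (cong₂ _≐_ (subT-single-wkT u (f · u)) (cong (_· u) (subT-single-wkT u f)))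
    (cong₂ _≐_ (subT-single-wkT u' (f · u)) (cong (_· u') (subT-single-wkT u' f))) e (≐-refl (f · u))

  ·-congˡ : ∀ {Γ Δ σ τ} {f f' : Tm Γ (σ ⇒ τ)} (u : Tm Γ σ) → Γ ⨾ Δ ⊢ f ≐ f' → Γ ⨾ Δ ⊢ f · u ≐ f' · u
  ·-congˡ {f = f} {f'} u e = ≐-subst-atomic (wkT (f · u) ≐ var here · wkT u) (at-≐ _ _)
    (cong₂ _≐_ (subT-single-wkT f (f · u)) (cong (f ·_) (subT-single-wkT f u)))
    (cong₂ _≐_ (subT-single-wkT f' (f · u)) (cong (f' ·_) (subT-single-wkT f' u))) e (≐-refl (f · u))

  ·-cong : ∀ {Γ Δ σ τ} {f f' : Tm Γ (σ ⇒ τ)} {u u' : Tm Γ σ} →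
           Γ ⨾ Δ ⊢ f ≐ f' → Γ ⨾ Δ ⊢ u ≐ u' → Γ ⨾ Δ ⊢ f · u ≐ f' · u'
  ·-cong {f' = f'} {u = u} e₁ e₂ = ≐-trans (·-congˡ u e₁) (·-congʳ f' e₂)

  ∈-congˡ : ∀ {Γ Δ ρ} {a a' : Tm Γ ρ} {b : Tm Γ (ρ *)} → Γ ⨾ Δ ⊢ a ≐ a' → Γ ⨾ Δ ⊢ a ∈' b → Γ ⨾ Δ ⊢ a' ∈' b
  ∈-congˡ {a = a} {a'} {b} = ≐-subst-atomic (var here ∈' wkT b) (at-∈ _ _)
    (cong (a ∈'_) (subT-single-wkT a b)) (cong (a' ∈'_) (subT-single-wkT a' b))

  ∈-congʳ : ∀ {Γ Δ ρ} {a : Tm Γ ρ} {b b' : Tm Γ (ρ *)} → Γ ⨾ Δ ⊢ b ≐ b' → Γ ⨾ Δ ⊢ a ∈' b → Γ ⨾ Δ ⊢ a ∈' b'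
  ∈-congʳ {a = a} {b} {b'} = ≐-subst-atomic (wkT a ∈' var here) (at-∈ _ _)
    (cong (_∈' b) (subT-single-wkT b a)) (cong (_∈' b') (subT-single-wkT b' a))

  rel-congᵢ : ∀ {Γ Δ} R (us : Vec (Tm Γ G) (relAr R)) i v →
              Γ ⨾ Δ ⊢ Vec.lookup us i ≐ v → Γ ⨾ Δ ⊢ rel R us → Γ ⨾ Δ ⊢ rel R (us [ i ]≔ v)
  rel-congᵢ R us i v = ≐-subst-atomic (rel R (Vec.map wkT us [ i ]≔ var here)) (at-rel _ _)
    (cong (rel R) (trans (substituted (Vec.lookup us i)) ([]≔-lookup us i)))
    (cong (rel R) (substituted v))
    where
      substituted : ∀ u → Vec.map (subT (single u)) (Vec.map wkT us [ i ]≔ var here) ≡ us [ i ]≔ u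
      substituted u = trans (map-[]≔ _ (Vec.map wkT us) i)
        (cong (_[ i ]≔ u) (trans (sym (map-∘ _ _ us)) (trans (map-cong (subT-single-wkT u) us) (map-id us))))

  -- The equality axiom rewrites one argument of a relation at a time.
  transport-pointwise : ∀ {Γ Δ n} (P : Vec (Tm Γ G) n → Set) →
                        (∀ us i v → Γ ⨾ Δ ⊢ Vec.lookup us i ≐ v → P us → P (us [ i ]≔ v)) →
                        ∀ us vs → (∀ i → Γ ⨾ Δ ⊢ Vec.lookup us i ≐ Vec.lookup vs i) → P us → P vs
  transport-pointwise P update Vec.[] Vec.[] e p = p
  transport-pointwise P update (u ∷ us) (v ∷ vs) e p =
    transport-pointwise (λ ws → P (v ∷ ws)) (λ ws i → update (v ∷ ws) (suc i)) us vs (e ∘ suc) (update (u ∷ us) zero v (e zero) p)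

  SubEq : ∀ {Γ Γ'} → List (Fm Γ') → Sub Γ Γ' → Sub Γ Γ' → Set
  SubEq {Γ' = Γ'} Δ s₁ s₂ = ∀ {τ} (x : _ ∋ τ) → Γ' ⨾ Δ ⊢ s₁ x ≐ s₂ x

  subT-≐ : ∀ {Γ Γ' Δ τ} {s₁ s₂ : Sub Γ Γ'} → SubEq Δ s₁ s₂ → (t : Tm Γ τ) → Γ' ⨾ Δ ⊢ subT s₁ t ≐ subT s₂ t
  subT-≐ e (var x) = e x
  subT-≐ e (con c) = ≐-refl _
  subT-≐ e (t · u) = ·-cong (subT-≐ e t) (subT-≐ e u)

  SubEq-sym : ∀ {Γ Γ' Δ} {s₁ s₂ : Sub Γ Γ'} → SubEq Δ s₁ s₂ → SubEq Δ s₂ s₁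
  SubEq-sym e x = ≐-sym (e x)

  SubEq-wk₁ : ∀ {Γ Γ' Δ B} {s₁ s₂ : Sub Γ Γ'} → SubEq Δ s₁ s₂ → SubEq (B ∷ Δ) s₁ s₂
  SubEq-wk₁ e x = ⊢-wk₁ (e x)

  SubEq-liftS : ∀ {Γ Γ' Δ τ} {s₁ s₂ : Sub Γ Γ'} → SubEq Δ s₁ s₂ → SubEq (lmap wkF Δ) (liftS {σ = τ} s₁) (liftS s₂)
  SubEq-liftS e here      = ≐-refl _
  SubEq-liftS e (there x) = ⊢-wk (e x)

  liftR-there-[var] : ∀ {Γ τ} (X : Fm (τ ∷ Γ)) → renF (liftR there) X [ var here ] ≡ X
  liftR-there-[var] X = trans (cong (_[ var here ]) (renF≡subF (liftR there) X))
    (trans (subF²-cong _ _ var var pointwise X) (trans (subF-id _) (subF-id X)))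
    where
      pointwise : single (var here) ⊙ renSub (liftR there) ≗s var ⊙ var
      pointwise here      = refl
      pointwise (there x) = refl

  ∀-open : ∀ {Γ Δ τ} {X : Fm (τ ∷ Γ)} → Γ ⨾ Δ ⊢ ∀' τ X → τ ∷ Γ ⨾ lmap wkF Δ ⊢ X
  ∀-open {X = X} d = cast (liftR-there-[var] X) (∀E (⊢-wk d) (var here))

  ∃-var : ∀ {Γ τ Δ} {X : Fm (τ ∷ Γ)} → τ ∷ Γ ⨾ Δ ⊢ X → τ ∷ Γ ⨾ Δ ⊢ wkF (∃' τ X)
  ∃-var {X = X} d = ∃I (var here) (cast (sym (liftR-there-[var] X)) d)

  ∀∈I : ∀ {Γ Δ σ} {t : Tm Γ (σ *)} {A} → σ ∷ Γ ⨾ var here ∈' wkT t ∷ lmap wkF Δ ⊢ A → Γ ⨾ Δ ⊢ ∀∈ t A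
  ∀∈I {t = t} {A} d = ⇒E (∧E₂ (ax (∀∈-def t A))) (∀I (⇒I d))

  ∀∈-unfold : ∀ {Γ Δ σ} {t : Tm Γ (σ *)} {A} → Γ ⨾ Δ ⊢ ∀∈ t A → Γ ⨾ Δ ⊢ ∀' σ (var here ∈' wkT t ⇒' A)
  ∀∈-unfold {t = t} {A} = ⇒E (∧E₁ (ax (∀∈-def t A)))

  ∀∈-inst : ∀ {Γ Δ σ} {t : Tm Γ (σ *)} {A} {u : Tm Γ σ} → Γ ⨾ Δ ⊢ ∀∈ t A → Γ ⨾ Δ ⊢ u ∈' t → Γ ⨾ Δ ⊢ A [ u ]
  ∀∈-inst {t = t} {A} {u} d m = ⇒E (cast (cong (λ z → (u ∈' z) ⇒' A [ u ]) (subT-single-wkT u t)) (∀E (∀∈-unfold d) u)) m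

  ∀∈E : ∀ {Γ Δ σ} {t : Tm Γ (σ *)} {A} → Γ ⨾ Δ ⊢ ∀∈ t A → σ ∷ Γ ⨾ var here ∈' wkT t ∷ lmap wkF Δ ⊢ A
  ∀∈E {A = A} d = cast (liftR-there-[var] A) (∀∈-inst (⊢-wk₁ (⊢-wk d)) hyp₀)

  ∃∈I : ∀ {Γ Δ σ} {t : Tm Γ (σ *)} {A} (u : Tm Γ σ) → Γ ⨾ Δ ⊢ u ∈' t → Γ ⨾ Δ ⊢ A [ u ] → Γ ⨾ Δ ⊢ ∃∈ t A
  ∃∈I {t = t} {A} u m d =
    ⇒E (∧E₂ (ax (∃∈-def t A))) (∃I u (∧I (cast (cong (u ∈'_) (sym (subT-single-wkT u t))) m) d))

  ∃∈E : ∀ {Γ Δ σ} {t : Tm Γ (σ *)} {A C} →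
        Γ ⨾ Δ ⊢ ∃∈ t A → σ ∷ Γ ⨾ A ∷ var here ∈' wkT t ∷ lmap wkF Δ ⊢ wkF C → Γ ⨾ Δ ⊢ C
  ∃∈E {t = t} {A} d e = ∃E (⇒E (∧E₁ (ax (∃∈-def t A))) d) (cast (subF-id _) (⊢-sub e var split))
    where
      split : SubHyps var (A ∷ var here ∈' wkT t ∷ _) ((var here ∈' wkT t ∧' A) ∷ _)
      split (here refl)         = cast (sym (subF-id _)) (∧E₂ hyp₀)
      split (there (here refl)) = cast (sym (subF-id _)) (∧E₁ hyp₀)
      split (there (there p))   = cast (sym (subF-id _)) (hyp (there p))

  ∃∈-var : ∀ {Γ σ Δ} {t : Tm Γ (σ *)} {A : Fm (σ ∷ Γ)} →
           σ ∷ Γ ⨾ Δ ⊢ var here ∈' wkT t → σ ∷ Γ ⨾ Δ ⊢ A → σ ∷ Γ ⨾ Δ ⊢ wkF (∃∈ t A)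
  ∃∈-var {A = A} m d = ∃∈I (var here) m (cast (sym (liftR-there-[var] A)) d)

  ∃∈-map : ∀ {Γ Δ σ} {t : Tm Γ (σ *)} {A B} →
           Γ ⨾ Δ ⊢ ∃∈ t A → σ ∷ Γ ⨾ A ∷ var here ∈' wkT t ∷ lmap wkF Δ ⊢ B → Γ ⨾ Δ ⊢ ∃∈ t B
  ∃∈-map d e = ∃∈E d (∃∈-var hyp₁ e)

  leibniz-sub : ∀ {Γ Γ' Δ} (A : Fm Γ) {s₁ s₂ : Sub Γ Γ'} → SubEq Δ s₁ s₂ → Γ' ⨾ Δ ⊢ subF s₁ A → Γ' ⨾ Δ ⊢ subF s₂ A
  leibniz-sub ⊥'         e d = d
  leibniz-sub (t ≐ u)    e d = ≐-trans (≐-sym (subT-≐ e t)) (≐-trans d (subT-≐ e u))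
  leibniz-sub (t ∈' u)   e d = ∈-congʳ (subT-≐ e u) (∈-congˡ (subT-≐ e t) d)
  leibniz-sub (rel R ts) {s₁} {s₂} e d =
    transport-pointwise (λ vs → _ ⨾ _ ⊢ rel R vs) (rel-congᵢ R) (Vec.map (subT s₁) ts) (Vec.map (subT s₂) ts)
      (λ i → cast (sym (cong₂ _≐_ (lookup-map i (subT s₁) ts) (lookup-map i (subT s₂) ts))) (subT-≐ e (Vec.lookup ts i))) d
  leibniz-sub (A ∨' B)   e d = ∨E d (∨I₁ (leibniz-sub A (SubEq-wk₁ e) hyp₀)) (∨I₂ (leibniz-sub B (SubEq-wk₁ e) hyp₀))
  leibniz-sub (A ∧' B)   e d = ∧I (leibniz-sub A e (∧E₁ d)) (leibniz-sub B e (∧E₂ d))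
  leibniz-sub (A ⇒' B)   e d = ⇒I (leibniz-sub B (SubEq-wk₁ e) (⇒E (⊢-wk₁ d) (leibniz-sub A (SubEq-wk₁ (SubEq-sym e)) hyp₀)))
  leibniz-sub (∀' τ A)   e d = ∀I (leibniz-sub A (SubEq-liftS e) (∀-open d))
  leibniz-sub (∃' τ A)   e d = ∃E d (∃-var (leibniz-sub A (SubEq-wk₁ (SubEq-liftS e)) hyp₀))
  leibniz-sub (∀∈ t A)   e d = ∀∈I (leibniz-sub A (SubEq-wk₁ (SubEq-liftS e))
    (cast (liftR-there-[var] _) (∀∈-inst (⊢-wk₁ (⊢-wk d)) (∈-congʳ (⊢-wk₁ (⊢-wk (≐-sym (subT-≐ e t)))) hyp₀))))
  leibniz-sub (∃∈ t A)   e d = ∃∈E d (∃∈-var (∈-congʳ (⊢-wk₁ (⊢-wk₁ (⊢-wk (subT-≐ e t)))) hyp₁)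
    (leibniz-sub A (SubEq-wk₁ (SubEq-wk₁ (SubEq-liftS e))) hyp₀))

  leibniz : ∀ {Γ Δ ρ} (A : Fm (ρ ∷ Γ)) {s t : Tm Γ ρ} → Γ ⨾ Δ ⊢ s ≐ t → Γ ⨾ Δ ⊢ A [ s ] → Γ ⨾ Δ ⊢ A [ t ]
  leibniz A {s} {t} e = leibniz-sub A single-≐
    where
      single-≐ : SubEq _ (single s) (single t)
      single-≐ here      = e
      single-≐ (there x) = ≐-refl _

  Kc : ∀ {Γ σ τ} → Tm Γ (σ ⇒ τ ⇒ σ)
  Kc = con (Πc _ _)

  Sc : ∀ {Γ ρ σ τ} → Tm Γ ((ρ ⇒ σ ⇒ τ) ⇒ (ρ ⇒ σ) ⇒ ρ ⇒ τ)
  Sc = con (Σc _ _ _)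

  Ic : ∀ {Γ σ} → Tm Γ (σ ⇒ σ)
  Ic {σ = σ} = Sc · Kc {τ = σ ⇒ σ} · Kc {τ = σ}

  lam : ∀ {Γ σ τ} → Tm (σ ∷ Γ) τ → Tm Γ (σ ⇒ τ)
  lam (var here)      = Ic
  lam (var (there x)) = Kc · var x
  lam (con c)         = Kc · con c
  lam (t · u)         = Sc · lam t · lam u

  ext : ∀ {Γ Δ σ} → Tm Δ σ → Sub Γ Δ → Sub (σ ∷ Γ) Δ
  ext u s here      = u
  ext u s (there x) = s x

  Ic-β : ∀ {Γ Δ σ} (u : Tm Γ σ) → Γ ⨾ Δ ⊢ Ic · u ≐ u
  Ic-β u = ≐-trans (ax (Σ-ax _ _ u)) (ax (Π-ax u _))

  lam-β : ∀ {Γ Δ Δ' σ τ} (s : Sub Γ Δ) (t : Tm (σ ∷ Γ) τ) (u : Tm Δ σ) → Δ ⨾ Δ' ⊢ subT s (lam t) · u ≐ subT (ext u s) t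
  lam-β s (var here)      u = Ic-β u
  lam-β s (var (there x)) u = ax (Π-ax _ _)
  lam-β s (con c)         u = ax (Π-ax _ _)
  lam-β s (t · t')        u = ≐-trans (ax (Σ-ax _ _ u)) (·-cong (lam-β s t u) (lam-β s t' u))

  ext-var : ∀ {Γ σ} (u : Tm Γ σ) → ext u var ≗s single u
  ext-var u here      = refl
  ext-var u (there x) = refl

  lam-β-single : ∀ {Γ Δ σ τ} (t : Tm (σ ∷ Γ) τ) (u : Tm Γ σ) → Γ ⨾ Δ ⊢ lam t · u ≐ subT (single u) t
  lam-β-single t u = cast (cong₂ (λ f b → f · u ≐ b) (subT-id (lam t)) (subT-cong (ext-var u) t)) (lam-β var t u)

  lam-β-var : ∀ {Γ σ Δ τ} (t : Tm (σ ∷ Γ) τ) → σ ∷ Γ ⨾ Δ ⊢ wkT (lam t) · var here ≐ t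
  lam-β-var t = cast (cong₂ (λ f b → f · var here ≐ b) (sym (renT≡subT there (lam t))) (trans (subT-cong ext-there t) (subT-id t)))
                     (lam-β (renSub there) t (var here))
    where
      ext-there : ext (var here) (renSub there) ≗s var
      ext-there here      = refl
      ext-there (there x) = refl

  -- Every type is inhabited thanks to the constant c₀ of 𝓛; default terms serve as realizers
  -- where any realizer will do.
  default : ∀ {Γ} τ → Tm Γ τ
  default G       = subst (Tm _) (cong funTy c₀-const) (con (fun c₀))
  default (σ ⇒ τ) = Kc · default τ
  default (σ *)   = con (sng σ) · default σ

  data Tys : Set where
    nil  : Tys
    one  : Ty → Tys
    pair : Tys → Tys → Tys

  infixr 25 _⇛_
  _⇛_ : Tys → Ty → Ty
  nil      ⇛ ρ = ρ
  one τ    ⇛ ρ = τ ⇒ ρ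
  pair a b ⇛ ρ = a ⇛ (b ⇛ ρ)

  mapTys : (Ty → Ty) → Tys → Tys
  mapTys f nil        = nil
  mapTys f (one τ)    = one (f τ)
  mapTys f (pair a b) = pair (mapTys f a) (mapTys f b)

  infixr 24 _⊕_
  _⊕_ : Tys → Ctx → Ctx
  nil      ⊕ Γ = Γ
  one τ    ⊕ Γ = τ ∷ Γ
  pair a b ⊕ Γ = b ⊕ (a ⊕ Γ)

  Tms : Ctx → Tys → Set
  Tms Γ nil        = ⊤
  Tms Γ (one τ)    = Tm Γ τ
  Tms Γ (pair a b) = Tms Γ a × Tms Γ b

  defaults : ∀ {Γ} P → Tms Γ P
  defaults nil        = tt
  defaults (one τ)    = default τ
  defaults (pair a b) = defaults a , defaults b

  subTs : ∀ {Γ Δ} P → Sub Γ Δ → Tms Γ P → Tms Δ P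
  subTs nil        s _       = tt
  subTs (one τ)    s t       = subT s t
  subTs (pair a b) s (x , y) = subTs a s x , subTs b s y

  renTs : ∀ {Γ Δ} P → Ren Γ Δ → Tms Γ P → Tms Δ P
  renTs nil        r _       = tt
  renTs (one τ)    r t       = renT r t
  renTs (pair a b) r (x , y) = renTs a r x , renTs b r y

  wkP : ∀ P {Γ} → Ren Γ (P ⊕ Γ)
  wkP nil        x = x
  wkP (one τ)    x = there x
  wkP (pair a b) x = wkP b (wkP a x)

  wks : ∀ P {Γ Δ} → Sub Γ Δ → Sub Γ (P ⊕ Δ)
  wks P s x = renT (wkP P) (s x)

  liftP : ∀ P {Γ Δ} → Sub Γ Δ → Sub (P ⊕ Γ) (P ⊕ Δ)
  liftP nil        s = s
  liftP (one τ)    s = liftS s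
  liftP (pair a b) s = liftP b (liftP a s)

  extS : ∀ P {Γ Δ} → Tms Δ P → Sub Γ Δ → Sub (P ⊕ Γ) Δ
  extS nil        _       s = s
  extS (one τ)    u       s = ext u s
  extS (pair a b) (x , y) s = extS b y (extS a x s)

  vars : ∀ P {Γ} → Tms (P ⊕ Γ) P
  vars nil        = tt
  vars (one τ)    = var here
  vars (pair a b) = renTs a (wkP b) (vars a) , vars b

  ∀⃗ : ∀ P {Γ} → Fm (P ⊕ Γ) → Fm Γ
  ∀⃗ nil        X = X
  ∀⃗ (one τ)    X = ∀' τ X
  ∀⃗ (pair a b) X = ∀⃗ a (∀⃗ b X)

  wkHs : ∀ P {Γ} → List (Fm Γ) → List (Fm (P ⊕ Γ))
  wkHs nil        Δ = Δ
  wkHs (one τ)    Δ = lmap wkF Δ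
  wkHs (pair a b) Δ = wkHs b (wkHs a Δ)

  app : ∀ P {Γ ρ} → Tm Γ (P ⇛ ρ) → Tms Γ P → Tm Γ ρ
  app nil        f _       = f
  app (one τ)    f u       = f · u
  app (pair a b) f (x , y) = app b (app a f x) y

  Λ : ∀ P {Γ ρ} → Tm (P ⊕ Γ) ρ → Tm Γ (P ⇛ ρ)
  Λ nil        t = t
  Λ (one τ)    t = lam t
  Λ (pair a b) t = Λ a (Λ b t)

  appM : ∀ P Q {Γ} → Tms Γ (mapTys (P ⇛_) Q) → Tms Γ P → Tms Γ Q
  appM P nil        f       xs = tt
  appM P (one τ)    f       xs = app P f xs
  appM P (pair a b) (f , g) xs = appM P a f xs , appM P b g xs

  ΛM : ∀ P Q {Γ} → Tms (P ⊕ Γ) Q → Tms Γ (mapTys (P ⇛_) Q)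
  ΛM P nil        t       = tt
  ΛM P (one τ)    t       = Λ P t
  ΛM P (pair a b) (t , u) = ΛM P a t , ΛM P b u

  EqTs : ∀ {Γ} (Δ : List (Fm Γ)) P → Tms Γ P → Tms Γ P → Set
  EqTs Δ nil        _       _         = ⊤
  EqTs Δ (one τ)    t       u         = _ ⨾ Δ ⊢ t ≐ u
  EqTs Δ (pair a b) (x , y) (x' , y') = EqTs Δ a x x' × EqTs Δ b y y'

  EqTs-sym : ∀ {Γ} {Δ : List (Fm Γ)} P {a b : Tms Γ P} → EqTs Δ P a b → EqTs Δ P b a
  EqTs-sym nil        e          = tt
  EqTs-sym (one τ)    e          = ≐-sym e
  EqTs-sym (pair P Q) (e₁ , e₂) = EqTs-sym P e₁ , EqTs-sym Q e₂

  app-congˡ : ∀ P {Γ Δ ρ} {f f' : Tm Γ (P ⇛ ρ)} (xs : Tms Γ P) → Γ ⨾ Δ ⊢ f ≐ f' → Γ ⨾ Δ ⊢ app P f xs ≐ app P f' xs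
  app-congˡ nil        xs      e = e
  app-congˡ (one τ)    x       e = ·-congˡ x e
  app-congˡ (pair a b) (x , y) e = app-congˡ b y (app-congˡ a x e)

  Λ-β : ∀ P {Γ Δ Δ' ρ} (s : Sub Γ Δ) (t : Tm (P ⊕ Γ) ρ) (us : Tms Δ P) →
        Δ ⨾ Δ' ⊢ app P (subT s (Λ P t)) us ≐ subT (extS P us s) t
  Λ-β nil        s t us      = ≐-refl _
  Λ-β (one τ)    s t u       = lam-β s t u
  Λ-β (pair a b) s t (x , y) = ≐-trans (app-congˡ b y (Λ-β a s (Λ b t) x)) (Λ-β b (extS a x s) t y)

  ΛM-β : ∀ P Q {Γ Δ Δ'} (s : Sub Γ Δ) (ts : Tms (P ⊕ Γ) Q) (us : Tms Δ P) →
         EqTs Δ' Q (appM P Q (subTs (mapTys (P ⇛_) Q) s (ΛM P Q ts)) us) (subTs Q (extS P us s) ts)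
  ΛM-β P nil        s ts      us = tt
  ΛM-β P (one τ)    s t       us = Λ-β P s t us
  ΛM-β P (pair a b) s (t , u) us = ΛM-β P a s t us , ΛM-β P b s u us

  subTs-cong : ∀ P {Γ Δ} {s s' : Sub Γ Δ} → s ≗s s' → (a : Tms Γ P) → subTs P s a ≡ subTs P s' a
  subTs-cong nil        e a       = refl
  subTs-cong (one τ)    e a       = subT-cong e a
  subTs-cong (pair P Q) e (a , b) = cong₂ _,_ (subTs-cong P e a) (subTs-cong Q e b)

  subTs-id : ∀ P {Γ} (a : Tms Γ P) → subTs P var a ≡ a
  subTs-id nil        a       = refl
  subTs-id (one τ)    a       = subT-id a
  subTs-id (pair P Q) (a , b) = cong₂ _,_ (subTs-id P a) (subTs-id Q b)

  renTs≡subTs : ∀ {Γ Δ} P (r : Ren Γ Δ) (a : Tms Γ P) → renTs P r a ≡ subTs P (renSub r) a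
  renTs≡subTs nil        r a       = refl
  renTs≡subTs (one τ)    r a       = renT≡subT r a
  renTs≡subTs (pair P Q) r (a , b) = cong₂ _,_ (renTs≡subTs P r a) (renTs≡subTs Q r b)

  renTs-renTs : ∀ P {Γ Δ Θ} (r : Ren Δ Θ) (r' : Ren Γ Δ) (a : Tms Γ P) → renTs P r (renTs P r' a) ≡ renTs P (r ∘ r') a
  renTs-renTs nil        r r' a       = refl
  renTs-renTs (one τ)    r r' a       = renT-renT r r' a
  renTs-renTs (pair P Q) r r' (a , b) = cong₂ _,_ (renTs-renTs P r r' a) (renTs-renTs Q r r' b)

  renTs-id : ∀ P {Γ} (a : Tms Γ P) → renTs P (λ x → x) a ≡ a
  renTs-id nil        a       = refl
  renTs-id (one τ)    a       = trans (renT≡subT _ a) (subT-id a)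
  renTs-id (pair P Q) (a , b) = cong₂ _,_ (renTs-id P a) (renTs-id Q b)

  subTs-single-renTs : ∀ P {Γ σ} (u : Tm Γ σ) (a : Tms Γ P) → subTs P (single u) (renTs P there a) ≡ a
  subTs-single-renTs nil        u a       = refl
  subTs-single-renTs (one τ)    u a       = subT-single-wkT u a
  subTs-single-renTs (pair P Q) u (a , b) = cong₂ _,_ (subTs-single-renTs P u a) (subTs-single-renTs Q u b)

  liftP-wkP : ∀ P {Γ Δ τ} (s : Sub Γ Δ) (x : Γ ∋ τ) → liftP P s (wkP P x) ≡ renT (wkP P) (s x)
  liftP-wkP nil        s x = sym (trans (renT≡subT (λ y → y) (s x)) (subT-id (s x)))
  liftP-wkP (one τ)    s x = refl
  liftP-wkP (pair a b) s x =
    trans (liftP-wkP b (liftP a s) (wkP a x)) (trans (cong (renT (wkP b)) (liftP-wkP a s x)) (renT-renT (wkP b) (wkP a) (s x)))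

  subT-liftP-wkP : ∀ P {Γ Δ τ} (s : Sub Γ Δ) (u : Tm Γ τ) → subT (liftP P s) (renT (wkP P) u) ≡ renT (wkP P) (subT s u)
  subT-liftP-wkP P s u = trans (subT-renT (liftP P s) (wkP P) u) (trans (subT-cong (liftP-wkP P s) u) (sym (renT-subT (wkP P) s u)))

  subTs-liftP-wkP : ∀ P Q {Γ Δ} (s : Sub Γ Δ) (us : Tms Γ Q) → subTs Q (liftP P s) (renTs Q (wkP P) us) ≡ renTs Q (wkP P) (subTs Q s us)
  subTs-liftP-wkP P nil        s us      = refl
  subTs-liftP-wkP P (one τ)    s u       = subT-liftP-wkP P s u
  subTs-liftP-wkP P (pair a b) s (x , y) = cong₂ _,_ (subTs-liftP-wkP P a s x) (subTs-liftP-wkP P b s y)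

  wks-⊙ : ∀ P {Γ Δ Θ} (s' : Sub Δ Θ) (s : Sub Γ Δ) → liftP P s' ⊙ wks P s ≗s wks P (s' ⊙ s)
  wks-⊙ P s' s x = subT-liftP-wkP P s' (s x)

  subTs-liftP-vars : ∀ P {Γ Δ} (s : Sub Γ Δ) → subTs P (liftP P s) (vars P) ≡ vars P
  subTs-liftP-vars nil        s = refl
  subTs-liftP-vars (one τ)    s = refl
  subTs-liftP-vars (pair a b) s =
    cong₂ _,_ (trans (subTs-liftP-wkP b a (liftP a s) (vars a)) (cong (renTs a (wkP b)) (subTs-liftP-vars a s)))
              (subTs-liftP-vars b (liftP a s))

  subT-app : ∀ P {Γ Δ ρ} (s : Sub Γ Δ) (f : Tm Γ (P ⇛ ρ)) (xs : Tms Γ P) → subT s (app P f xs) ≡ app P (subT s f) (subTs P s xs)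
  subT-app nil        s f xs      = refl
  subT-app (one τ)    s f xs      = refl
  subT-app (pair a b) s f (x , y) = trans (subT-app b s (app a f x) y) (cong (λ z → app b z (subTs b s y)) (subT-app a s f x))

  subTs-appM : ∀ P Q {Γ Δ} (s : Sub Γ Δ) (f : Tms Γ (mapTys (P ⇛_) Q)) (xs : Tms Γ P) →
               subTs Q s (appM P Q f xs) ≡ appM P Q (subTs (mapTys (P ⇛_) Q) s f) (subTs P s xs)
  subTs-appM P nil        s f       xs = refl
  subTs-appM P (one τ)    s f       xs = subT-app P s f xs
  subTs-appM P (pair a b) s (f , g) xs = cong₂ _,_ (subTs-appM P a s f xs) (subTs-appM P b s g xs)

  renT-app : ∀ P {Γ Δ ρ} (r : Ren Γ Δ) (f : Tm Γ (P ⇛ ρ)) (xs : Tms Γ P) → renT r (app P f xs) ≡ app P (renT r f) (renTs P r xs)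
  renT-app nil        r f xs      = refl
  renT-app (one τ)    r f xs      = refl
  renT-app (pair a b) r f (x , y) = trans (renT-app b r (app a f x) y) (cong (λ z → app b z (renTs b r y)) (renT-app a r f x))

  renTs-appM : ∀ P Q {Γ Δ} (r : Ren Γ Δ) (f : Tms Γ (mapTys (P ⇛_) Q)) (xs : Tms Γ P) →
               renTs Q r (appM P Q f xs) ≡ appM P Q (renTs _ r f) (renTs P r xs)
  renTs-appM P nil        r f       xs = refl
  renTs-appM P (one τ)    r f       xs = renT-app P r f xs
  renTs-appM P (pair a b) r (f , g) xs = cong₂ _,_ (renTs-appM P a r f xs) (renTs-appM P b r g xs)

  extS-wkP : ∀ P {Γ Δ τ} (xs : Tms Δ P) (s : Sub Γ Δ) (x : Γ ∋ τ) → extS P xs s (wkP P x) ≡ s x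
  extS-wkP nil        xs       s x = refl
  extS-wkP (one τ)    xs       s x = refl
  extS-wkP (pair a b) (x' , y) s x = trans (extS-wkP b y (extS a x' s) (wkP a x)) (extS-wkP a x' s x)

  subT-extS-wkP : ∀ P {Γ Δ τ} (xs : Tms Δ P) (s : Sub Γ Δ) (u : Tm Γ τ) → subT (extS P xs s) (renT (wkP P) u) ≡ subT s u
  subT-extS-wkP P xs s u = trans (subT-renT (extS P xs s) (wkP P) u) (subT-cong (extS-wkP P xs s) u)

  subTs-extS-wkP : ∀ P Q {Γ Δ} (xs : Tms Δ P) (s : Sub Γ Δ) (us : Tms Γ Q) → subTs Q (extS P xs s) (renTs Q (wkP P) us) ≡ subTs Q s us
  subTs-extS-wkP P nil        xs s us      = refl
  subTs-extS-wkP P (one τ)    xs s u       = subT-extS-wkP P xs s u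
  subTs-extS-wkP P (pair a b) xs s (x , y) = cong₂ _,_ (subTs-extS-wkP P a xs s x) (subTs-extS-wkP P b xs s y)

  subTs-extS-vars : ∀ P {Γ Δ} (xs : Tms Δ P) (s : Sub Γ Δ) → subTs P (extS P xs s) (vars P) ≡ xs
  subTs-extS-vars nil        xs      s = refl
  subTs-extS-vars (one τ)    xs      s = refl
  subTs-extS-vars (pair a b) (x , y) s =
    cong₂ _,_ (trans (subTs-extS-wkP b a y (extS a x s) (vars a)) (subTs-extS-vars a x s)) (subTs-extS-vars b y (extS a x s))

  extS-cong : ∀ P {Γ Δ} (xs : Tms Δ P) {s s' : Sub Γ Δ} → s ≗s s' → extS P xs s ≗s extS P xs s'
  extS-cong nil        xs      e x         = e x
  extS-cong (one τ)    u       e here      = refl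
  extS-cong (one τ)    u       e (there x) = e x
  extS-cong (pair a b) (x , y) e           = extS-cong b y (extS-cong a x e)

  extS-⊙-liftP : ∀ P {Γ Γ' Δ} (ys : Tms Δ P) (s₀ : Sub Γ' Δ) (s' : Sub Γ Γ') → extS P ys s₀ ⊙ liftP P s' ≗s extS P ys (s₀ ⊙ s')
  extS-⊙-liftP nil        ys      s₀ s' x         = refl
  extS-⊙-liftP (one τ)    ys      s₀ s' here      = refl
  extS-⊙-liftP (one τ)    ys      s₀ s' (there x) = subT-renT (ext ys s₀) there (s' x)
  extS-⊙-liftP (pair a b) (x , y) s₀ s' z         =
    trans (extS-⊙-liftP b y (extS a x s₀) (liftP a s') z) (extS-cong b y (extS-⊙-liftP a x s₀ s') z)

  extS-renTs-vars : ∀ P {Γ Θ} (r : Ren (P ⊕ Γ) Θ) → extS P (renTs P r (vars P)) (renSub (r ∘ wkP P)) ≗s renSub r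
  extS-renTs-vars nil        r x         = refl
  extS-renTs-vars (one τ)    r here      = refl
  extS-renTs-vars (one τ)    r (there x) = refl
  extS-renTs-vars (pair a b) r x         =
    trans (extS-cong b _ (λ z → trans (cong (λ q → extS a q (renSub (r ∘ wkP b ∘ wkP a)) z) (renTs-renTs a r (wkP b) (vars a)))
                                      (extS-renTs-vars a (r ∘ wkP b) z)) x)
          (extS-renTs-vars b r x)

  extS-vars : ∀ P {Γ} → extS P (vars P) (renSub (wkP P)) ≗s var {Γ = P ⊕ Γ}
  extS-vars P x = trans (cong (λ q → extS P q (renSub (wkP P)) x) (sym (renTs-id P (vars P)))) (extS-renTs-vars P (λ y → y) x)

  ΛM-β-vars : ∀ P Q {Γ Δ} (c : Tms (P ⊕ Γ) Q) → EqTs Δ Q c (appM P Q (renTs _ (wkP P) (ΛM P Q c)) (vars P))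
  ΛM-β-vars P Q c = EqTs-sym Q (subst₂ (EqTs _ Q)
    (cong (λ f → appM P Q f (vars P)) (sym (renTs≡subTs _ (wkP P) (ΛM P Q c))))
    (trans (subTs-cong Q (extS-vars P) c) (subTs-id Q c))
    (ΛM-β P Q (renSub (wkP P)) c (vars P)))

  subF-∀⃗ : ∀ P {Γ Δ} (s : Sub Γ Δ) (X : Fm (P ⊕ Γ)) → subF s (∀⃗ P X) ≡ ∀⃗ P (subF (liftP P s) X)
  subF-∀⃗ nil        s X = refl
  subF-∀⃗ (one τ)    s X = refl
  subF-∀⃗ (pair a b) s X = trans (subF-∀⃗ a s (∀⃗ b X)) (cong (∀⃗ a) (subF-∀⃗ b (liftP a s) X))

  ∀⃗I : ∀ P {Γ Δ X} → P ⊕ Γ ⨾ wkHs P Δ ⊢ X → Γ ⨾ Δ ⊢ ∀⃗ P X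
  ∀⃗I nil        d = d
  ∀⃗I (one τ)    d = ∀I d
  ∀⃗I (pair a b) d = ∀⃗I a (∀⃗I b d)

  ∀⃗E : ∀ P {Γ Δ X} → Γ ⨾ Δ ⊢ ∀⃗ P X → (us : Tms Γ P) → Γ ⨾ Δ ⊢ subF (extS P us var) X
  ∀⃗E nil                d us      = cast (sym (subF-id _)) d
  ∀⃗E (one τ)    {X = X} d u       = cast (subF-cong (λ x → sym (ext-var u x)) X) (∀E d u)
  ∀⃗E (pair a b) {X = X} d (x , y) =
    cast (trans (subF-subF _ _ X) (subF-cong (λ z → trans (extS-⊙-liftP b y var (extS a x var) z) (extS-cong b y (λ w → subT-id _) z)) X))
         (∀⃗E b (cast (subF-∀⃗ b (extS a x var) X) (∀⃗E a d x)) y)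

  ⊢-wkP : ∀ P {Γ Δ X} → Γ ⨾ Δ ⊢ X → P ⊕ Γ ⨾ wkHs P Δ ⊢ subF (renSub (wkP P)) X
  ⊢-wkP nil        {X = X} d = cast (sym (subF-id X)) d
  ⊢-wkP (one τ)    {X = X} d = cast (wkF≡subF X) (⊢-wk d)
  ⊢-wkP (pair a b) {X = X} d = cast (subF-subF _ _ X) (⊢-wkP b (⊢-wkP a d))

  ∀⃗-open : ∀ P {Γ Δ Z} → Γ ⨾ Δ ⊢ ∀⃗ P Z → P ⊕ Γ ⨾ wkHs P Δ ⊢ Z
  ∀⃗-open P {Z = Z} d =
    cast (trans (subF-subF _ _ Z) (trans (subF-cong (λ x → trans (extS-⊙-liftP P (vars P) var (renSub (wkP P)) x) (extS-vars P x)) Z) (subF-id Z)))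
         (∀⃗E P (cast (subF-∀⃗ P _ Z) (⊢-wkP P d)) (vars P))

  SubEq-refl : ∀ {Γ Δ} → SubEq {Γ} {Γ} Δ var var
  SubEq-refl x = ≐-refl _

  SubEq-extS : ∀ P {Γ Δ Δ'} (xs ys : Tms Δ P) {s₁ s₂ : Sub Γ Δ} → EqTs Δ' P xs ys → SubEq Δ' s₁ s₂ →
               SubEq Δ' (extS P xs s₁) (extS P ys s₂)
  SubEq-extS nil        xs      ys        e         p           = p
  SubEq-extS (one τ)    u       v         e         p here      = e
  SubEq-extS (one τ)    u       v         e         p (there x) = p x
  SubEq-extS (pair a b) (x , y) (x' , y') (e₁ , e₂) p           = SubEq-extS b y y' e₂ (SubEq-extS a x x' e₁ p)

  -- Realizability

  data RType : Set where
    rnil  : RType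
    rpair : RType → RType → RType
    rimp  : RType → RType → RType
    rall  : Ty → RType → RType
    rex   : Ty → RType → RType

  flat : RType → Tys
  flat rnil        = nil
  flat (rpair a b) = pair (flat a) (flat b)
  flat (rimp a b)  = mapTys (flat a ⇛_) (flat b)
  flat (rall σ a)  = mapTys (one σ ⇛_) (flat a)
  flat (rex σ a)   = pair (one (σ *)) (flat a)

  -- Realizer types are read off the formula; keeping the formula as an index makes
  -- them invariant under substitution without any transport.
  data Shape {Γ : Ctx} : Fm Γ → RType → Set where
    s⊥   : Shape ⊥' rnil
    s≐   : ∀ {ρ} {t u : Tm Γ ρ} → Shape (t ≐ u) rnil
    s∈   : ∀ {ρ} {t : Tm Γ ρ} {u} → Shape (t ∈' u) rnil
    srel : ∀ {R ts} → Shape (rel R ts) rnil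
    s∨   : ∀ {A B a b} → Shape A a → Shape B b → Shape (A ∨' B) (rpair a b)
    s∧   : ∀ {A B a b} → Shape A a → Shape B b → Shape (A ∧' B) (rpair a b)
    s⇒   : ∀ {A B a b} → Shape A a → Shape B b → Shape (A ⇒' B) (rimp a b)
    s∀   : ∀ {σ A a} → Shape A a → Shape (∀' σ A) (rall σ a)
    s∃   : ∀ {σ A a} → Shape A a → Shape (∃' σ A) (rex σ a)
    s∀∈  : ∀ {σ} {t : Tm Γ (σ *)} {A a} → Shape A a → Shape (∀∈ t A) a
    s∃∈  : ∀ {σ} {t : Tm Γ (σ *)} {A a} → Shape A a → Shape (∃∈ t A) a

  shape : ∀ {Γ} (A : Fm Γ) → Σ RType (Shape A)
  shape ⊥'         = _ , s⊥
  shape (t ≐ u)    = _ , s≐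
  shape (t ∈' u)   = _ , s∈
  shape (rel R ts) = _ , srel
  shape (A ∨' B)   = _ , s∨ (proj₂ (shape A)) (proj₂ (shape B))
  shape (A ∧' B)   = _ , s∧ (proj₂ (shape A)) (proj₂ (shape B))
  shape (A ⇒' B)   = _ , s⇒ (proj₂ (shape A)) (proj₂ (shape B))
  shape (∀' σ A)   = _ , s∀ (proj₂ (shape A))
  shape (∃' σ A)   = _ , s∃ (proj₂ (shape A))
  shape (∀∈ t A)   = _ , s∀∈ (proj₂ (shape A))
  shape (∃∈ t A)   = _ , s∃∈ (proj₂ (shape A))

  Shape-det : ∀ {Γ} {A : Fm Γ} {R R'} → Shape A R → Shape A R' → R ≡ R'
  Shape-det s⊥        s⊥        = refl
  Shape-det s≐        s≐        = refl
  Shape-det s∈        s∈        = refl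
  Shape-det srel      srel      = refl
  Shape-det (s∨ x x') (s∨ y y') = cong₂ rpair (Shape-det x y) (Shape-det x' y')
  Shape-det (s∧ x x') (s∧ y y') = cong₂ rpair (Shape-det x y) (Shape-det x' y')
  Shape-det (s⇒ x x') (s⇒ y y') = cong₂ rimp (Shape-det x y) (Shape-det x' y')
  Shape-det (s∀ x)    (s∀ y)    = cong (rall _) (Shape-det x y)
  Shape-det (s∃ x)    (s∃ y)    = cong (rex _) (Shape-det x y)
  Shape-det (s∀∈ x)   (s∀∈ y)   = Shape-det x y
  Shape-det (s∃∈ x)   (s∃∈ y)   = Shape-det x y

  Shape-unique : ∀ {Γ} {A : Fm Γ} {R} (x y : Shape A R) → x ≡ y
  Shape-unique s⊥        s⊥        = refl
  Shape-unique s≐        s≐        = refl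
  Shape-unique s∈        s∈        = refl
  Shape-unique srel      srel      = refl
  Shape-unique (s∨ x x') (s∨ y y') = cong₂ s∨ (Shape-unique x y) (Shape-unique x' y')
  Shape-unique (s∧ x x') (s∧ y y') = cong₂ s∧ (Shape-unique x y) (Shape-unique x' y')
  Shape-unique (s⇒ x x') (s⇒ y y') = cong₂ s⇒ (Shape-unique x y) (Shape-unique x' y')
  Shape-unique (s∀ x)    (s∀ y)    = cong s∀ (Shape-unique x y)
  Shape-unique (s∃ x)    (s∃ y)    = cong s∃ (Shape-unique x y)
  Shape-unique (s∀∈ x)   (s∀∈ y)   = cong s∀∈ (Shape-unique x y)
  Shape-unique (s∃∈ x)   (s∃∈ y)   = cong s∃∈ (Shape-unique x y)

  Shape-subF : ∀ {Γ Δ} {A : Fm Γ} {R} → Shape A R → (s : Sub Γ Δ) → Shape (subF s A) R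
  Shape-subF s⊥       s = s⊥
  Shape-subF s≐       s = s≐
  Shape-subF s∈       s = s∈
  Shape-subF srel     s = srel
  Shape-subF (s∨ x y) s = s∨ (Shape-subF x s) (Shape-subF y s)
  Shape-subF (s∧ x y) s = s∧ (Shape-subF x s) (Shape-subF y s)
  Shape-subF (s⇒ x y) s = s⇒ (Shape-subF x s) (Shape-subF y s)
  Shape-subF (s∀ x)   s = s∀ (Shape-subF x (liftS s))
  Shape-subF (s∃ x)   s = s∃ (Shape-subF x (liftS s))
  Shape-subF (s∀∈ x)  s = s∀∈ (Shape-subF x (liftS s))
  Shape-subF (s∃∈ x)  s = s∃∈ (Shape-subF x (liftS s))

  Shape-unsubF : ∀ {Γ Δ} (A : Fm Γ) (s : Sub Γ Δ) {R} → Shape (subF s A) R → Shape A R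
  Shape-unsubF ⊥'         s s⊥       = s⊥
  Shape-unsubF (t ≐ u)    s s≐       = s≐
  Shape-unsubF (t ∈' u)   s s∈       = s∈
  Shape-unsubF (rel R ts) s srel     = srel
  Shape-unsubF (A ∨' B)   s (s∨ x y) = s∨ (Shape-unsubF A s x) (Shape-unsubF B s y)
  Shape-unsubF (A ∧' B)   s (s∧ x y) = s∧ (Shape-unsubF A s x) (Shape-unsubF B s y)
  Shape-unsubF (A ⇒' B)   s (s⇒ x y) = s⇒ (Shape-unsubF A s x) (Shape-unsubF B s y)
  Shape-unsubF (∀' σ A)   s (s∀ x)   = s∀ (Shape-unsubF A (liftS s) x)
  Shape-unsubF (∃' σ A)   s (s∃ x)   = s∃ (Shape-unsubF A (liftS s) x)
  Shape-unsubF (∀∈ t A)   s (s∀∈ x)  = s∀∈ (Shape-unsubF A (liftS s) x)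
  Shape-unsubF (∃∈ t A)   s (s∃∈ x)  = s∃∈ (Shape-unsubF A (liftS s) x)

  Shape-unrenF : ∀ {Γ Δ} (A : Fm Γ) (r : Ren Γ Δ) {R} → Shape (renF r A) R → Shape A R
  Shape-unrenF A r {R} x = Shape-unsubF A (renSub r) (subst (λ X → Shape X R) (renF≡subF r A) x)

  -- mr sh s a is "a mr A[s]"; carrying the substitution lets realizers live in the target context.
  mr : ∀ {Γ Δ} {A : Fm Γ} {R} → Shape A R → Sub Γ Δ → Tms Δ (flat R) → Fm Δ
  mr s⊥                       s _       = ⊥'
  mr (s≐ {t = t} {u})         s _       = subT s t ≐ subT s u
  mr (s∈ {t = t} {u})         s _       = subT s t ∈' subT s u
  mr (srel {R} {ts})          s _       = rel R (Vec.map (subT s) ts)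
  mr (s∨ x y)                 s (a , b) = mr x s a ∨' mr y s b
  mr (s∧ x y)                 s (a , b) = mr x s a ∧' mr y s b
  mr (s⇒ {A} {B} {ra} {rb} x y) s f     =
    (subF s A ⇒' subF s B) ∧'
    ∀⃗ (flat ra) (mr x (wks (flat ra) s) (vars (flat ra)) ⇒'
                 mr y (wks (flat ra) s) (appM (flat ra) (flat rb) (renTs _ (wkP (flat ra)) f) (vars (flat ra))))
  mr (s∀ {σ} {a = ra} x)      s f       = ∀' σ (mr x (liftS s) (appM (one σ) (flat ra) (renTs _ there f) (var here)))
  mr (s∃ {a = ra} x)          s (w , a) = ∃∈ w (mr x (liftS s) (renTs (flat ra) there a))
  mr (s∀∈ {t = t} {a = ra} x) s a       = ∀∈ (subT s t) (mr x (liftS s) (renTs (flat ra) there a))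
  mr (s∃∈ {t = t} {a = ra} x) s a       = ∃∈ (subT s t) (mr x (liftS s) (renTs (flat ra) there a))

  mr-cong : ∀ {Γ Δ} {A : Fm Γ} {R} (sh : Shape A R) {s s' : Sub Γ Δ} → s ≗s s' → (a : Tms Δ (flat R)) → mr sh s a ≡ mr sh s' a
  mr-cong s⊥               e a       = refl
  mr-cong (s≐ {t = t} {u}) e a       = cong₂ _≐_ (subT-cong e t) (subT-cong e u)
  mr-cong (s∈ {t = t} {u}) e a       = cong₂ _∈'_ (subT-cong e t) (subT-cong e u)
  mr-cong (srel {R} {ts})  e a       = cong (rel R) (map-cong (subT-cong e) ts)
  mr-cong (s∨ x y)         e (a , b) = cong₂ _∨'_ (mr-cong x e a) (mr-cong y e b)
  mr-cong (s∧ x y)         e (a , b) = cong₂ _∧'_ (mr-cong x e a) (mr-cong y e b)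
  mr-cong (s⇒ {A} {B} {ra} x y) e f  = cong₂ _∧'_ (cong₂ _⇒'_ (subF-cong e A) (subF-cong e B))
    (cong (∀⃗ (flat ra)) (cong₂ _⇒'_ (mr-cong x wks-e _) (mr-cong y wks-e _)))
    where
      wks-e = λ {σ} (x : _ ∋ σ) → cong (renT (wkP (flat ra))) (e x)
  mr-cong (s∀ x)           e f       = cong (∀' _) (mr-cong x (liftS-cong e) _)
  mr-cong (s∃ x)           e (w , a) = cong (∃∈ w) (mr-cong x (liftS-cong e) _)
  mr-cong (s∀∈ {t = t} x)  e a       = cong₂ ∀∈ (subT-cong e t) (mr-cong x (liftS-cong e) _)
  mr-cong (s∃∈ {t = t} x)  e a       = cong₂ ∃∈ (subT-cong e t) (mr-cong x (liftS-cong e) _)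

  subF-mr-liftS : ∀ {Γ Δ Θ σ} {A : Fm (σ ∷ Γ)} {R} (sh : Shape A R) (s : Sub Γ Δ) (s' : Sub Δ Θ) (a : Tms (σ ∷ Δ) (flat R)) →
                  subF (liftS s') (mr sh (liftS s) a) ≡ mr sh (liftS (s' ⊙ s)) (subTs (flat R) (liftS s') a)
  subF-mr : ∀ {Γ Δ Θ} {A : Fm Γ} {R} (sh : Shape A R) (s : Sub Γ Δ) (s' : Sub Δ Θ) (a : Tms Δ (flat R)) →
            subF s' (mr sh s a) ≡ mr sh (s' ⊙ s) (subTs (flat R) s' a)
  subF-mr s⊥               s s' a       = refl
  subF-mr (s≐ {t = t} {u}) s s' a       = cong₂ _≐_ (subT-subT s' s t) (subT-subT s' s u)
  subF-mr (s∈ {t = t} {u}) s s' a       = cong₂ _∈'_ (subT-subT s' s t) (subT-subT s' s u)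
  subF-mr (srel {R} {ts})  s s' a       = cong (rel R) (trans (sym (map-∘ _ _ ts)) (map-cong (subT-subT s' s) ts))
  subF-mr (s∨ x y)         s s' (a , b) = cong₂ _∨'_ (subF-mr x s s' a) (subF-mr y s s' b)
  subF-mr (s∧ x y)         s s' (a , b) = cong₂ _∧'_ (subF-mr x s s' a) (subF-mr y s s' b)
  subF-mr (s⇒ {A} {B} {ra} {rb} x y) s s' f =
    cong₂ _∧'_ (cong₂ _⇒'_ (subF-subF s' s A) (subF-subF s' s B))
      (trans (subF-∀⃗ P s' _) (cong (∀⃗ P) (cong₂ _⇒'_ premise conclusion)))
    where
      P = flat ra
      Q = flat rb
      under-wks : ∀ {A' R'} (sh : Shape A' R') b → subF (liftP P s') (mr sh (wks P s) b) ≡ mr sh (wks P (s' ⊙ s)) (subTs (flat R') (liftP P s') b)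
      under-wks sh b = trans (subF-mr sh (wks P s) (liftP P s') b) (mr-cong sh (wks-⊙ P s' s) _)
      premise = trans (under-wks x (vars P)) (cong (mr x (wks P (s' ⊙ s))) (subTs-liftP-vars P s'))
      conclusion = trans (under-wks y _) (cong (mr y (wks P (s' ⊙ s)))
        (trans (subTs-appM P Q (liftP P s') _ (vars P))
               (cong₂ (appM P Q) (subTs-liftP-wkP P (mapTys (P ⇛_) Q) s' f) (subTs-liftP-vars P s'))))
  subF-mr (s∀ {σ} {a = ra} x) s s' f =
    cong (∀' σ) (trans (subF-mr-liftS x s s' _) (cong (mr x (liftS (s' ⊙ s)))
      (trans (subTs-appM (one σ) (flat ra) (liftS s') _ (var here))
             (cong (λ g → appM (one σ) (flat ra) g (var here)) (subTs-liftP-wkP (one σ) (mapTys (one σ ⇛_) (flat ra)) s' f)))))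
  subF-mr (s∃ {σ} {a = ra} x) s s' (w , a) =
    cong (∃∈ (subT s' w)) (trans (subF-mr-liftS x s s' _) (cong (mr x (liftS (s' ⊙ s))) (subTs-liftP-wkP (one σ) (flat ra) s' a)))
  subF-mr (s∀∈ {σ} {t = t} {a = ra} x) s s' a =
    cong₂ ∀∈ (subT-subT s' s t) (trans (subF-mr-liftS x s s' _) (cong (mr x (liftS (s' ⊙ s))) (subTs-liftP-wkP (one σ) (flat ra) s' a)))
  subF-mr (s∃∈ {σ} {t = t} {a = ra} x) s s' a =
    cong₂ ∃∈ (subT-subT s' s t) (trans (subF-mr-liftS x s s' _) (cong (mr x (liftS (s' ⊙ s))) (subTs-liftP-wkP (one σ) (flat ra) s' a)))

  subF-mr-liftS sh s s' a = trans (subF-mr sh (liftS s) (liftS s') a) (mr-cong sh (liftS-⊙ s' s) _)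

  mr-Shape-subF-liftS : ∀ {Γ Γ' Δ σ} {A : Fm (σ ∷ Γ)} {R} (sh : Shape A R) (r : Sub Γ Γ') (s : Sub Γ' Δ) (a : Tms (σ ∷ Δ) (flat R)) →
                        mr (Shape-subF sh (liftS r)) (liftS s) a ≡ mr sh (liftS (s ⊙ r)) a
  mr-Shape-subF : ∀ {Γ Γ' Δ} {A : Fm Γ} {R} (sh : Shape A R) (r : Sub Γ Γ') (s : Sub Γ' Δ) (a : Tms Δ (flat R)) →
                  mr (Shape-subF sh r) s a ≡ mr sh (s ⊙ r) a
  mr-Shape-subF s⊥               r s a       = refl
  mr-Shape-subF (s≐ {t = t} {u}) r s a       = cong₂ _≐_ (subT-subT s r t) (subT-subT s r u)
  mr-Shape-subF (s∈ {t = t} {u}) r s a       = cong₂ _∈'_ (subT-subT s r t) (subT-subT s r u)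
  mr-Shape-subF (srel {R} {ts})  r s a       = cong (rel R) (trans (sym (map-∘ _ _ ts)) (map-cong (subT-subT s r) ts))
  mr-Shape-subF (s∨ x y)         r s (a , b) = cong₂ _∨'_ (mr-Shape-subF x r s a) (mr-Shape-subF y r s b)
  mr-Shape-subF (s∧ x y)         r s (a , b) = cong₂ _∧'_ (mr-Shape-subF x r s a) (mr-Shape-subF y r s b)
  mr-Shape-subF (s⇒ {A} {B} {ra} x y) r s f  =
    cong₂ _∧'_ (cong₂ _⇒'_ (subF-subF s r A) (subF-subF s r B))
      (cong (∀⃗ (flat ra)) (cong₂ _⇒'_ (under-wks x) (under-wks y)))
    where
      under-wks : ∀ {A' R'} (sh : Shape A' R') {b} → mr (Shape-subF sh r) (wks (flat ra) s) b ≡ mr sh (wks (flat ra) (s ⊙ r)) b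
      under-wks sh = trans (mr-Shape-subF sh r _ _) (mr-cong sh (λ z → sym (renT-subT (wkP (flat ra)) s (r z))) _)
  mr-Shape-subF (s∀ x)           r s f       = cong (∀' _) (mr-Shape-subF-liftS x r s _)
  mr-Shape-subF (s∃ x)           r s (w , a) = cong (∃∈ w) (mr-Shape-subF-liftS x r s _)
  mr-Shape-subF (s∀∈ {t = t} x)  r s a       = cong₂ ∀∈ (subT-subT s r t) (mr-Shape-subF-liftS x r s _)
  mr-Shape-subF (s∃∈ {t = t} x)  r s a       = cong₂ ∃∈ (subT-subT s r t) (mr-Shape-subF-liftS x r s _)

  mr-Shape-subF-liftS sh r s a = trans (mr-Shape-subF sh (liftS r) (liftS s) a) (mr-cong sh (liftS-⊙ s r) a)

  mr-irrelevant : ∀ {Γ Δ} {A A' : Fm Γ} {R} (x : Shape A R) (y : Shape A' R) → A ≡ A' →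
                  (s : Sub Γ Δ) (a : Tms Δ (flat R)) → mr x s a ≡ mr y s a
  mr-irrelevant x y refl s a = cong (λ z → mr z s a) (Shape-unique x y)

  mr-vars : ∀ {Γ Δ} {A : Fm Γ} {R} (sh : Shape A R) (s : Sub Γ Δ) (a : Tms Δ (flat R)) →
            subF (extS (flat R) a var) (mr sh (wks (flat R) s) (vars (flat R))) ≡ mr sh s a
  mr-vars {R = R} sh s a = trans (subF-mr sh (wks (flat R) s) (extS (flat R) a var) (vars (flat R)))
    (trans (mr-cong sh (λ x → trans (subT-extS-wkP (flat R) a var (s x)) (subT-id (s x))) _)
           (cong (mr sh s) (subTs-extS-vars (flat R) a var)))

  mr-≐ : ∀ {Γ Δ Δ'} {A : Fm Γ} {R} (sh : Shape A R) (s : Sub Γ Δ) (a a' : Tms Δ (flat R)) →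
         EqTs Δ' (flat R) a a' → Δ ⨾ Δ' ⊢ mr sh s a → Δ ⨾ Δ' ⊢ mr sh s a'
  mr-≐ {R = R} sh s a a' e d = cast (mr-vars sh s a')
    (leibniz-sub (mr sh (wks (flat R) s) (vars (flat R))) (SubEq-extS (flat R) a a' e SubEq-refl) (cast (sym (mr-vars sh s a)) d))

  mr⇒truth : ∀ {Γ Δ Δ'} {A : Fm Γ} {R} (sh : Shape A R) (s : Sub Γ Δ) (a : Tms Δ (flat R)) →
             Δ ⨾ Δ' ⊢ mr sh s a → Δ ⨾ Δ' ⊢ subF s A
  mr⇒truth s⊥       s a       d = d
  mr⇒truth s≐       s a       d = d
  mr⇒truth s∈       s a       d = d
  mr⇒truth srel     s a       d = d
  mr⇒truth (s∨ x y) s (a , b) d = ∨E d (∨I₁ (mr⇒truth x s a hyp₀)) (∨I₂ (mr⇒truth y s b hyp₀))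
  mr⇒truth (s∧ x y) s (a , b) d = ∧I (mr⇒truth x s a (∧E₁ d)) (mr⇒truth y s b (∧E₂ d))
  mr⇒truth (s⇒ x y) s f       d = ∧E₁ d
  mr⇒truth (s∀ x)   s f       d = ∀I (mr⇒truth x (liftS s) _ (∀-open d))
  mr⇒truth (s∃ x)   s (w , a) d = ∃∈E d (∃-var (mr⇒truth x (liftS s) _ hyp₀))
  mr⇒truth (s∀∈ x)  s a       d = ∀∈I (mr⇒truth x (liftS s) _ (∀∈E d))
  mr⇒truth (s∃∈ x)  s a       d = ∃∈-map d (mr⇒truth x (liftS s) _ hyp₀)

  subF-wkP : ∀ P {Γ Δ} (s : Sub Γ Δ) (A : Fm Γ) → subF (renSub (wkP P)) (subF s A) ≡ subF (wks P s) A
  subF-wkP P s A = trans (subF-subF _ s A) (subF-cong (λ x → sym (renT≡subT (wkP P) (s x))) A)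

  ExFree⇒mr : ∀ {Γ Δ Δ'} {A : Fm Γ} {R} → ExFree A → (sh : Shape A R) (s : Sub Γ Δ) (a : Tms Δ (flat R)) →
              Δ ⨾ Δ' ⊢ subF s A → Δ ⨾ Δ' ⊢ mr sh s a
  ExFree⇒mr (ef-at at-⊥)         s⊥       s a       d = d
  ExFree⇒mr (ef-at (at-≐ _ _))   s≐       s a       d = d
  ExFree⇒mr (ef-at (at-∈ _ _))   s∈       s a       d = d
  ExFree⇒mr (ef-at (at-rel _ _)) srel     s a       d = d
  ExFree⇒mr (ef-∨ e₁ e₂)         (s∨ x y) s (a , b) d = ∨E d (∨I₁ (ExFree⇒mr e₁ x s a hyp₀)) (∨I₂ (ExFree⇒mr e₂ y s b hyp₀))
  ExFree⇒mr (ef-∧ e₁ e₂)         (s∧ x y) s (a , b) d = ∧I (ExFree⇒mr e₁ x s a (∧E₁ d)) (ExFree⇒mr e₂ y s b (∧E₂ d))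
  ExFree⇒mr {A = A ⇒' B} (ef-⇒ e₁ e₂) (s⇒ {a = ra} x y) s f d =
    ∧I d (∀⃗I P (⇒I (ExFree⇒mr e₂ y _ _ (⇒E (⊢-wk₁ d') (mr⇒truth x _ _ hyp₀)))))
    where
      P = flat ra
      d' = cast (cong₂ _⇒'_ (subF-wkP P s A) (subF-wkP P s B)) (⊢-wkP P d)
  ExFree⇒mr (ef-∀ e)             (s∀ x)   s f       d = ∀I (ExFree⇒mr e x (liftS s) _ (∀-open d))
  ExFree⇒mr (ef-∀∈ e)            (s∀∈ x)  s a       d = ∀∈I (ExFree⇒mr e x (liftS s) _ (∀∈E d))
  ExFree⇒mr (ef-∃∈ e)            (s∃∈ x)  s a       d = ∃∈-map d (ExFree⇒mr e x (liftS s) _ hyp₀)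

  -- Monotonicity and unions of realizers

  data SetValued : Ty → Set where
    set* : ∀ {σ} → SetValued (σ *)
    set⇒ : ∀ {σ τ} → SetValued τ → SetValued (σ ⇒ τ)

  AllSetValued : Tys → Set
  AllSetValued nil        = ⊤
  AllSetValued (one τ)    = SetValued τ
  AllSetValued (pair a b) = AllSetValued a × AllSetValued b

  SetValued-⇛ : ∀ P {τ} → SetValued τ → SetValued (P ⇛ τ)
  SetValued-⇛ nil        e = e
  SetValued-⇛ (one σ)    e = set⇒ e
  SetValued-⇛ (pair a b) e = SetValued-⇛ a (SetValued-⇛ b e)

  AllSetValued-mapTys : ∀ P Q → AllSetValued Q → AllSetValued (mapTys (P ⇛_) Q)
  AllSetValued-mapTys P nil        e         = tt
  AllSetValued-mapTys P (one τ)    e         = SetValued-⇛ P e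
  AllSetValued-mapTys P (pair a b) (e₁ , e₂) = AllSetValued-mapTys P a e₁ , AllSetValued-mapTys P b e₂

  AllSetValued-flat : ∀ R → AllSetValued (flat R)
  AllSetValued-flat rnil        = tt
  AllSetValued-flat (rpair a b) = AllSetValued-flat a , AllSetValued-flat b
  AllSetValued-flat (rimp a b)  = AllSetValued-mapTys (flat a) (flat b) (AllSetValued-flat b)
  AllSetValued-flat (rall σ a)  = AllSetValued-mapTys (one σ) (flat a) (AllSetValued-flat a)
  AllSetValued-flat (rex σ a)   = set* , AllSetValued-flat a

  ⊤' : ∀ {Γ} → Fm Γ
  ⊤' = ⊥' ⇒' ⊥'

  ⊤'I : ∀ {Γ Δ} → Γ ⨾ Δ ⊢ ⊤'
  ⊤'I = ⇒I hyp₀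

  infix 35 _⊑_
  _⊑_ : ∀ {Γ τ} → Tm Γ τ → Tm Γ τ → Fm Γ
  _⊑_ {τ = G}     a b = a ≐ b
  _⊑_ {τ = σ *}   a b = ∀∈ a (var here ∈' wkT b)
  _⊑_ {τ = σ ⇒ τ} a b = ∀' σ (wkT a · var here ⊑ wkT b · var here)

  ⊑ᵖ : ∀ {Γ} P → Tms Γ P → Tms Γ P → Fm Γ
  ⊑ᵖ nil        _       _         = ⊤'
  ⊑ᵖ (one τ)    a       b         = a ⊑ b
  ⊑ᵖ (pair P Q) (a , b) (a' , b') = ⊑ᵖ P a a' ∧' ⊑ᵖ Q b b'

  syntax ⊑ᵖ P a b = a ⊑[ P ] b

  subF-⊑ : ∀ {Γ Δ τ} (s : Sub Γ Δ) (a b : Tm Γ τ) → subF s (a ⊑ b) ≡ subT s a ⊑ subT s b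
  subF-⊑ {τ = G}     s a b = refl
  subF-⊑ {τ = σ *}   s a b = cong (λ z → ∀∈ (subT s a) (var here ∈' z)) (subT-liftS-wkT s b)
  subF-⊑ {τ = σ ⇒ τ} s a b = cong (∀' σ) (trans (subF-⊑ (liftS s) _ _)
    (cong₂ (λ x y → x · var here ⊑ y · var here) (subT-liftS-wkT s a) (subT-liftS-wkT s b)))

  subF-⊑ᵖ : ∀ {Γ Δ} P (s : Sub Γ Δ) (a b : Tms Γ P) → subF s (a ⊑[ P ] b) ≡ subTs P s a ⊑[ P ] subTs P s b
  subF-⊑ᵖ nil        s a       b         = refl
  subF-⊑ᵖ (one τ)    s a       b         = subF-⊑ s a b
  subF-⊑ᵖ (pair P Q) s (a , b) (a' , b') = cong₂ _∧'_ (subF-⊑ᵖ P s a a') (subF-⊑ᵖ Q s b b')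

  ⊑ᵖ-wkP : ∀ P Q {Γ Δ} {a b : Tms Γ Q} → Γ ⨾ Δ ⊢ a ⊑[ Q ] b → P ⊕ Γ ⨾ wkHs P Δ ⊢ renTs Q (wkP P) a ⊑[ Q ] renTs Q (wkP P) b
  ⊑ᵖ-wkP P Q {a = a} {b} q =
    cast (trans (subF-⊑ᵖ Q (renSub (wkP P)) a b) (sym (cong₂ (⊑ᵖ Q) (renTs≡subTs Q (wkP P) a) (renTs≡subTs Q (wkP P) b))))
         (⊢-wkP P q)

  ⊑-≐ˡ : ∀ {Γ Δ τ} {a a' c : Tm Γ τ} → Γ ⨾ Δ ⊢ a ≐ a' → Γ ⨾ Δ ⊢ a ⊑ c → Γ ⨾ Δ ⊢ a' ⊑ c
  ⊑-≐ˡ {a = a} {a'} {c} e d = cast (at a') (leibniz (var here ⊑ wkT c) e (cast (sym (at a)) d))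
    where
      at : ∀ x → (var here ⊑ wkT c) [ x ] ≡ x ⊑ c
      at x = trans (subF-⊑ _ _ _) (cong (x ⊑_) (subT-single-wkT x c))

  ⊑-≐ʳ : ∀ {Γ Δ τ} {a c c' : Tm Γ τ} → Γ ⨾ Δ ⊢ c ≐ c' → Γ ⨾ Δ ⊢ a ⊑ c → Γ ⨾ Δ ⊢ a ⊑ c'
  ⊑-≐ʳ {a = a} {c} {c'} e d = cast (at c') (leibniz (wkT a ⊑ var here) e (cast (sym (at c)) d))
    where
      at : ∀ x → (wkT a ⊑ var here) [ x ] ≡ a ⊑ x
      at x = trans (subF-⊑ _ _ _) (cong (_⊑ x) (subT-single-wkT x a))

  ⊑-· : ∀ {Γ Δ σ τ} {f f' : Tm Γ (σ ⇒ τ)} → Γ ⨾ Δ ⊢ f ⊑ f' → (x : Tm Γ σ) → Γ ⨾ Δ ⊢ f · x ⊑ f' · x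
  ⊑-· {f = f} {f'} d x =
    cast (trans (subF-⊑ _ _ _) (cong₂ (λ g g' → g · x ⊑ g' · x) (subT-single-wkT x f) (subT-single-wkT x f'))) (∀E d x)

  ⊑-app : ∀ P {Γ Δ τ} {f f' : Tm Γ (P ⇛ τ)} → Γ ⨾ Δ ⊢ f ⊑ f' → (xs : Tms Γ P) → Γ ⨾ Δ ⊢ app P f xs ⊑ app P f' xs
  ⊑-app nil        d xs      = d
  ⊑-app (one σ)    d x       = ⊑-· d x
  ⊑-app (pair a b) d (x , y) = ⊑-app b (⊑-app a d x) y

  ⊑ᵖ-appM : ∀ P Q {Γ Δ} {f f' : Tms Γ (mapTys (P ⇛_) Q)} → Γ ⨾ Δ ⊢ f ⊑[ mapTys (P ⇛_) Q ] f' →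
            (xs : Tms Γ P) → Γ ⨾ Δ ⊢ appM P Q f xs ⊑[ Q ] appM P Q f' xs
  ⊑ᵖ-appM P nil        d xs = ⊤'I
  ⊑ᵖ-appM P (one τ)    d xs = ⊑-app P d xs
  ⊑ᵖ-appM P (pair a b) d xs = ∧I (⊑ᵖ-appM P a (∧E₁ d) xs) (⊑ᵖ-appM P b (∧E₂ d) xs)

  mr-mono : ∀ {Γ Δ Δ'} {A : Fm Γ} {R} (sh : Shape A R) (s : Sub Γ Δ) (a a' : Tms Δ (flat R)) →
            Δ ⨾ Δ' ⊢ a ⊑[ flat R ] a' → Δ ⨾ Δ' ⊢ mr sh s a → Δ ⨾ Δ' ⊢ mr sh s a'
  mr-mono s⊥       s a       a'        q d = d
  mr-mono s≐       s a       a'        q d = d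
  mr-mono s∈       s a       a'        q d = d
  mr-mono srel     s a       a'        q d = d
  mr-mono (s∨ x y) s (a , b) (a' , b') q d =
    ∨E d (∨I₁ (mr-mono x s a a' (⊢-wk₁ (∧E₁ q)) hyp₀)) (∨I₂ (mr-mono y s b b' (⊢-wk₁ (∧E₂ q)) hyp₀))
  mr-mono (s∧ x y) s (a , b) (a' , b') q d = ∧I (mr-mono x s a a' (∧E₁ q) (∧E₁ d)) (mr-mono y s b b' (∧E₂ q) (∧E₂ d))
  mr-mono (s⇒ {a = ra} {b = rb} x y) s f f' q d =
    ∧I (∧E₁ d) (∀⃗I P (⇒I (mr-mono y _ _ _ (⊢-wk₁ (⊑ᵖ-appM P Q (⊑ᵖ-wkP P (mapTys (P ⇛_) Q) q) (vars P)))
                                          (⇒E (⊢-wk₁ (∀⃗-open P (∧E₂ d))) hyp₀))))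
    where
      P = flat ra
      Q = flat rb
  mr-mono (s∀ {σ} {a = ra} x) s f f' q d =
    ∀I (mr-mono x _ _ _ (⊑ᵖ-appM (one σ) (flat ra) (⊑ᵖ-wkP (one σ) (mapTys (one σ ⇛_) (flat ra)) q) (var here)) (∀-open d))
  mr-mono (s∃ {σ} {a = ra} x) s (w , a) (w' , a') q d =
    ∃∈E d (∃∈-var (⊢-wk₁ (∀∈E (∧E₁ q))) (mr-mono x _ _ _ (⊢-wk₁ (⊢-wk₁ (⊑ᵖ-wkP (one σ) (flat ra) (∧E₂ q)))) hyp₀))
  mr-mono (s∀∈ {σ} {a = ra} x) s a a' q d = ∀∈I (mr-mono x _ _ _ (⊢-wk₁ (⊑ᵖ-wkP (one σ) (flat ra) q)) (∀∈E d))
  mr-mono (s∃∈ {σ} {a = ra} x) s a a' q d = ∃∈-map d (mr-mono x _ _ _ (⊢-wk₁ (⊢-wk₁ (⊑ᵖ-wkP (one σ) (flat ra) q))) hyp₀)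

  union : ∀ {Γ τ} → SetValued τ → Tm Γ τ → Tm Γ τ → Tm Γ τ
  union (set* {σ}) a b = con (cup σ) · a · b
  union (set⇒ e)   a b = lam (union e (wkT a · var here) (wkT b · var here))

  ⊑-unionˡ : ∀ {Γ Δ τ} (e : SetValued τ) (a b : Tm Γ τ) → Γ ⨾ Δ ⊢ a ⊑ union e a b
  ⊑-unionˡ set*     a b = ∀∈I (⇒E (∧E₂ (ax (cup-ax (var here) (wkT a) (wkT b)))) (∨I₁ hyp₀))
  ⊑-unionˡ (set⇒ e) a b = ∀I (⊑-≐ʳ (≐-sym (lam-β-var _)) (⊑-unionˡ e (wkT a · var here) (wkT b · var here)))

  ⊑-unionʳ : ∀ {Γ Δ τ} (e : SetValued τ) (a b : Tm Γ τ) → Γ ⨾ Δ ⊢ b ⊑ union e a b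
  ⊑-unionʳ set*     a b = ∀∈I (⇒E (∧E₂ (ax (cup-ax (var here) (wkT a) (wkT b)))) (∨I₂ hyp₀))
  ⊑-unionʳ (set⇒ e) a b = ∀I (⊑-≐ʳ (≐-sym (lam-β-var _)) (⊑-unionʳ e (wkT a · var here) (wkT b · var here)))

  unionᵖ : ∀ {Γ} P → AllSetValued P → Tms Γ P → Tms Γ P → Tms Γ P
  unionᵖ nil        e         a       b         = tt
  unionᵖ (one τ)    e         a       b         = union e a b
  unionᵖ (pair P Q) (e₁ , e₂) (a , b) (a' , b') = unionᵖ P e₁ a a' , unionᵖ Q e₂ b b'

  ⊑ᵖ-unionˡ : ∀ {Γ Δ} P (e : AllSetValued P) (a b : Tms Γ P) → Γ ⨾ Δ ⊢ a ⊑[ P ] unionᵖ P e a b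
  ⊑ᵖ-unionˡ nil        e         a       b         = ⊤'I
  ⊑ᵖ-unionˡ (one τ)    e         a       b         = ⊑-unionˡ e a b
  ⊑ᵖ-unionˡ (pair P Q) (e₁ , e₂) (a , b) (a' , b') = ∧I (⊑ᵖ-unionˡ P e₁ a a') (⊑ᵖ-unionˡ Q e₂ b b')

  ⊑ᵖ-unionʳ : ∀ {Γ Δ} P (e : AllSetValued P) (a b : Tms Γ P) → Γ ⨾ Δ ⊢ b ⊑[ P ] unionᵖ P e a b
  ⊑ᵖ-unionʳ nil        e         a       b         = ⊤'I
  ⊑ᵖ-unionʳ (one τ)    e         a       b         = ⊑-unionʳ e a b
  ⊑ᵖ-unionʳ (pair P Q) (e₁ , e₂) (a , b) (a' , b') = ∧I (⊑ᵖ-unionʳ P e₁ a a') (⊑ᵖ-unionʳ Q e₂ b b')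

  -- ⋃_{y ∈ w} f y; at a function type this is λx. ⋃_{y ∈ w} f y x.
  bigUnion : ∀ {Γ σ τ} → SetValued τ → Tm Γ (σ *) → Tm Γ (σ ⇒ τ) → Tm Γ τ
  bigUnion {σ = σ} (set* {ρ}) w f = con (bigcup σ ρ) · w · f
  bigUnion (set⇒ e)           w f = lam (bigUnion e (wkT w) (lam (wkT (wkT f) · var here · var (there here))))

  ⊑-bigUnion : ∀ {Γ Δ σ τ} (e : SetValued τ) (f : Tm Γ (σ ⇒ τ)) (u : Tm Γ σ) (w : Tm Γ (σ *)) →
               Γ ⨾ Δ ⊢ u ∈' w → Γ ⨾ Δ ⊢ f · u ⊑ bigUnion e w f
  ⊑-bigUnion set*     f u w m = ∀∈I (⇒E (ax (bigcup-mem (wkT u) (wkT w) (var here) (wkT f))) (∧I (⊢-wk₁ (⊢-wk m)) hyp₀))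
  ⊑-bigUnion (set⇒ e) f u w m =
    ∀I (⊑-≐ʳ (≐-sym (lam-β-var _)) (⊑-≐ˡ flip-β (⊑-bigUnion e _ (wkT u) (wkT w) (⊢-wk m))))
    where
      flipped = wkT (wkT f) · var here · var (there here)
      flip-β = cast (cong (λ g → lam flipped · wkT u ≐ g · wkT u · var here) (subT-single-wkT (wkT u) (wkT f)))
                    (lam-β-single flipped (wkT u))

  renT-lam : ∀ {Γ Δ σ τ} (r : Ren Γ Δ) (t : Tm (σ ∷ Γ) τ) → renT r (lam t) ≡ lam (renT (liftR r) t)
  renT-lam r (var here)      = refl
  renT-lam r (var (there x)) = refl
  renT-lam r (con c)         = refl
  renT-lam r (t · u)         = cong₂ (λ a b → Sc · a · b) (renT-lam r t) (renT-lam r u)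

  renT-liftR-wkT : ∀ {Γ Δ σ τ} (r : Ren Γ Δ) (t : Tm Γ τ) → renT (liftR {σ = σ} r) (wkT t) ≡ wkT (renT r t)
  renT-liftR-wkT r t = trans (renT-renT (liftR r) there t) (sym (renT-renT there r t))

  renT-bigUnion : ∀ {Γ Δ σ τ} (e : SetValued τ) (r : Ren Γ Δ) (w : Tm Γ (σ *)) (f : Tm Γ (σ ⇒ τ)) →
                  renT r (bigUnion e w f) ≡ bigUnion e (renT r w) (renT r f)
  renT-bigUnion set*     r w f = refl
  renT-bigUnion (set⇒ e) r w f = trans (renT-lam r _) (cong lam (trans (renT-bigUnion e (liftR r) _ _)
    (cong₂ (bigUnion e) (renT-liftR-wkT r w) (trans (renT-lam (liftR r) (wkT (wkT f) · var here · var (there here)))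
      (cong (λ g → lam (g · var here · var (there here))) (trans (renT-liftR-wkT (liftR r) (wkT f)) (cong wkT (renT-liftR-wkT r f))))))))

  bigUnionᵖ : ∀ {Γ σ} P → AllSetValued P → Tm Γ (σ *) → Tms Γ (mapTys (one σ ⇛_) P) → Tms Γ P
  bigUnionᵖ nil        e         w f       = tt
  bigUnionᵖ (one τ)    e         w f       = bigUnion e w f
  bigUnionᵖ (pair P Q) (e₁ , e₂) w (f , g) = bigUnionᵖ P e₁ w f , bigUnionᵖ Q e₂ w g

  ⊑ᵖ-bigUnionᵖ : ∀ {Γ σ Δ} P (e : AllSetValued P) (w : Tm Γ (σ *)) (f : Tms Γ (mapTys (one σ ⇛_) P)) →
                 σ ∷ Γ ⨾ Δ ⊢ var here ∈' wkT w →
                 σ ∷ Γ ⨾ Δ ⊢ appM (one σ) P (renTs _ there f) (var here) ⊑[ P ] renTs P there (bigUnionᵖ P e w f)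
  ⊑ᵖ-bigUnionᵖ nil        e         w f       m = ⊤'I
  ⊑ᵖ-bigUnionᵖ (one τ)    e         w f       m =
    cast (cong (_ ⊑_) (sym (renT-bigUnion e there w f))) (⊑-bigUnion e (wkT f) (var here) (wkT w) m)
  ⊑ᵖ-bigUnionᵖ (pair P Q) (e₁ , e₂) w (f , g) m = ∧I (⊑ᵖ-bigUnionᵖ P e₁ w f m) (⊑ᵖ-bigUnionᵖ Q e₂ w g m)

  single-⊙-liftS : ∀ {Γ Γ' σ} (u : Tm Γ' σ) (s : Sub Γ Γ') → single u ⊙ liftS s ≗s ext u s
  single-⊙-liftS u s here      = refl
  single-⊙-liftS u s (there x) = subT-single-wkT u (s x)

  mr-[] : ∀ {Γ Γ' σ} {A : Fm (σ ∷ Γ)} {R} (x : Shape A R) (s : Sub Γ Γ') (u : Tm Γ' σ) (a : Tms Γ' (flat R)) →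
          mr x (liftS s) (renTs (flat R) there a) [ u ] ≡ mr x (ext u s) a
  mr-[] {R = R} x s u a = trans (subF-mr x (liftS s) (single u) _)
    (trans (mr-cong x (single-⊙-liftS u s) _) (cong (mr x (ext u s)) (subTs-single-renTs (flat R) u a)))

  subF-renSub-mr : ∀ {Γ Γ' Γ''} {A : Fm Γ} {R} (r : Ren Γ' Γ'') (sh : Shape A R) (s : Sub Γ Γ') (a : Tms Γ' (flat R)) →
                   subF (renSub r) (mr sh s a) ≡ mr sh (renSub r ⊙ s) (renTs (flat R) r a)
  subF-renSub-mr {R = R} r sh s a = trans (subF-mr sh s (renSub r) a) (cong (mr sh _) (sym (renTs≡subTs (flat R) r a)))

  subF-wkP-mr : ∀ P {Γ Γ'} {A : Fm Γ} {R} (sh : Shape A R) (s : Sub Γ Γ') (a : Tms Γ' (flat R)) →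
                subF (renSub (wkP P)) (mr sh s a) ≡ mr sh (wks P s) (renTs (flat R) (wkP P) a)
  subF-wkP-mr P sh s a = trans (subF-renSub-mr (wkP P) sh s a) (mr-cong sh (λ z → sym (renT≡subT (wkP P) (s z))) _)

  mr-⇒I : ∀ {Γ Γ' Δ'} {A B : Fm Γ} {ra rb} (x : Shape A ra) (y : Shape B rb) (s : Sub Γ Γ') (c : Tms (flat ra ⊕ Γ') (flat rb)) →
          Γ' ⨾ Δ' ⊢ subF s A ⇒' subF s B →
          flat ra ⊕ Γ' ⨾ mr x (wks (flat ra) s) (vars (flat ra)) ∷ wkHs (flat ra) Δ' ⊢ mr y (wks (flat ra) s) c →
          Γ' ⨾ Δ' ⊢ mr (s⇒ x y) s (ΛM (flat ra) (flat rb) c)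
  mr-⇒I {ra = ra} {rb} x y s c dt dc = ∧I dt (∀⃗I (flat ra) (⇒I (mr-≐ y _ c _ (ΛM-β-vars (flat ra) (flat rb) c) dc)))

  mr-⇒E : ∀ {Γ Γ' Δ'} {A B : Fm Γ} {ra rb} (x : Shape A ra) (y : Shape B rb) (s : Sub Γ Γ')
          (f : Tms Γ' (mapTys (flat ra ⇛_) (flat rb))) (a : Tms Γ' (flat ra)) →
          Γ' ⨾ Δ' ⊢ mr (s⇒ x y) s f → Γ' ⨾ Δ' ⊢ mr x s a → Γ' ⨾ Δ' ⊢ mr y s (appM (flat ra) (flat rb) f a)
  mr-⇒E {ra = ra} {rb} x y s f a df da = ⇒E (cast (cong₂ _⇒'_ (mr-vars x s a) conclusion) (∀⃗E P (∧E₂ df) a)) da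
    where
      P = flat ra
      Q = flat rb
      conclusion = trans (subF-mr y (wks P s) (extS P a var) _)
        (trans (mr-cong y (λ z → trans (subT-extS-wkP P a var (s z)) (subT-id (s z))) _)
          (cong (mr y s) (trans (subTs-appM P Q (extS P a var) _ (vars P))
            (cong₂ (appM P Q) (trans (subTs-extS-wkP P (mapTys (P ⇛_) Q) a var f) (subTs-id _ f)) (subTs-extS-vars P a var)))))

  mr-∀I : ∀ {Γ Γ' Δ' σ} {A : Fm (σ ∷ Γ)} {ra} (x : Shape A ra) (s : Sub Γ Γ') (c : Tms (σ ∷ Γ') (flat ra)) →
          σ ∷ Γ' ⨾ lmap wkF Δ' ⊢ mr x (liftS s) c → Γ' ⨾ Δ' ⊢ mr (s∀ x) s (ΛM (one σ) (flat ra) c)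
  mr-∀I {σ = σ} {ra = ra} x s c d = ∀I (mr-≐ x (liftS s) c _ (ΛM-β-vars (one σ) (flat ra) c) d)

  mr-∀E : ∀ {Γ Γ' Δ' σ} {A : Fm (σ ∷ Γ)} {ra} (x : Shape A ra) (s : Sub Γ Γ') (f : Tms Γ' (mapTys (one σ ⇛_) (flat ra))) (t : Tm Γ' σ) →
          Γ' ⨾ Δ' ⊢ mr (s∀ x) s f → Γ' ⨾ Δ' ⊢ mr x (ext t s) (appM (one σ) (flat ra) f t)
  mr-∀E {σ = σ} {ra = ra} x s f t d = cast instance-eq (∀E d t)
    where
      instance-eq = trans (subF-mr x (liftS s) (single t) _) (trans (mr-cong x (single-⊙-liftS t s) _)
        (cong (mr x (ext t s)) (trans (subTs-appM (one σ) (flat ra) (single t) _ (var here))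
          (cong (λ g → appM (one σ) (flat ra) g t) (subTs-single-renTs _ t f)))))

  mr-∃I : ∀ {Γ Γ' Δ' σ} {A : Fm (σ ∷ Γ)} {ra} (x : Shape A ra) (s : Sub Γ Γ') (w : Tm Γ' (σ *)) (a : Tms Γ' (flat ra)) (u : Tm Γ' σ) →
          Γ' ⨾ Δ' ⊢ u ∈' w → Γ' ⨾ Δ' ⊢ mr x (ext u s) a → Γ' ⨾ Δ' ⊢ mr (s∃ x) s (w , a)
  mr-∃I x s w a u m d = ∃∈I u m (cast (sym (mr-[] x s u a)) d)

  ∈-sng : ∀ {Γ Δ σ} (u : Tm Γ σ) → Γ ⨾ Δ ⊢ u ∈' con (sng σ) · u
  ∈-sng u = ⇒E (∧E₂ (ax (sng-ax u u))) (≐-refl u)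

  mr-sng : ∀ {Γ Γ' Δ' σ} {A : Fm (σ ∷ Γ)} {ra} (x : Shape A ra) (s : Sub Γ Γ') (u : Tm Γ' σ) (a : Tms Γ' (flat ra)) →
           Γ' ⨾ Δ' ⊢ mr x (ext u s) a → Γ' ⨾ Δ' ⊢ mr (s∃ x) s (con (sng σ) · u , a)
  mr-sng x s u a = mr-∃I x s _ a u (∈-sng u)

  Realized : ∀ {Γ Γ'} → List (Fm Γ') → {A : Fm Γ} {R : RType} → Shape A R → Sub Γ Γ' → Set
  Realized {Γ' = Γ'} Δ' {R = R} sh s = Σ (Tms Γ' (flat R)) λ a → Γ' ⨾ Δ' ⊢ mr sh s a

  Realized-∧ : ∀ {Γ Γ' Δ'} {A B : Fm Γ} {ra rb} {x : Shape A ra} {y : Shape B rb} {s : Sub Γ Γ'} →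
               Realized Δ' x s → Realized Δ' y s → Realized Δ' (s∧ x y) s
  Realized-∧ (a , da) (b , db) = (a , b) , ∧I da db

  Env : ∀ {Γ Γ'} → Sub Γ Γ' → List (Fm Γ) → List (Fm Γ') → Set
  Env s Δ Δ' = ∀ {X} → X ∈ Δ → ∀ {R} (sh : Shape X R) → Realized Δ' sh s

  Env-∷ : ∀ {Γ Γ'} {s : Sub Γ Γ'} {Δ Δ'} {A : Fm Γ} {R} (x : Shape A R) (a : Tms Γ' (flat R)) →
          Env s Δ Δ' → Env s (A ∷ Δ) (mr x s a ∷ Δ')
  Env-∷ {s = s} x a env (here refl) y with Shape-det x y
  ... | refl = a , cast (cong (λ z → mr z s a) (Shape-unique x y)) hyp₀
  Env-∷ x a env (there p) y = proj₁ (env p y) , ⊢-wk₁ (proj₂ (env p y))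

  Env-wk₁ : ∀ {Γ Γ'} {s : Sub Γ Γ'} {Δ Δ' B} → Env s Δ Δ' → Env s Δ (B ∷ Δ')
  Env-wk₁ env p y = proj₁ (env p y) , ⊢-wk₁ (proj₂ (env p y))

  Env-cong : ∀ {Γ Γ'} {s s' : Sub Γ Γ'} {Δ Δ'} → s ≗s s' → Env s Δ Δ' → Env s' Δ Δ'
  Env-cong e env p y = proj₁ (env p y) , cast (mr-cong y e _) (proj₂ (env p y))

  Env-ren : ∀ {Γ Γ' Γ''} {s : Sub Γ Γ'} {Δ Δ' Δ''} (r : Ren Γ' Γ'') →
            (∀ {X} → Γ' ⨾ Δ' ⊢ X → Γ'' ⨾ Δ'' ⊢ subF (renSub r) X) → Env s Δ Δ' → Env (renSub r ⊙ s) Δ Δ''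
  Env-ren {s = s} r ren env p {R} y = renTs (flat R) r (proj₁ (env p y)) , cast (subF-renSub-mr r y s _) (ren (proj₂ (env p y)))

  Env-wkF : ∀ {Γ Γ' τ} {s : Sub (τ ∷ Γ) Γ'} {Δ Δ'} → Env (s ⊙ renSub there) Δ Δ' → Env s (lmap wkF Δ) Δ'
  Env-wkF {s = s} env p {R} y with ∈-map⁻ wkF p
  ... | X , q , refl = b , cast (trans (sym (mr-Shape-subF y₀ (renSub there) s b)) (mr-irrelevant _ y (sym (wkF≡subF X)) s b)) db
    where
      y₀ = Shape-unrenF X there y
      b = proj₁ (env q y₀)
      db = proj₂ (env q y₀)

  Env-liftS : ∀ {Γ Γ' τ} {s : Sub Γ Γ'} {Δ Δ'} → Env s Δ Δ' → Env (liftS {σ = τ} s) (lmap wkF Δ) (lmap wkF Δ')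
  Env-liftS {s = s} env = Env-wkF (Env-cong (λ x → sym (renT≡subT there (s x))) (Env-ren there (λ {X} d → cast (wkF≡subF X) (⊢-wk d)) env))

  Env-wks : ∀ P {Γ Γ'} {s : Sub Γ Γ'} {Δ Δ'} → Env s Δ Δ' → Env (wks P s) Δ (wkHs P Δ')
  Env-wks P {s = s} env = Env-cong (λ x → sym (renT≡subT (wkP P) (s x))) (Env-ren (wkP P) (⊢-wkP P) env)

  Env⇒SubHyps : ∀ {Γ Γ'} {s : Sub Γ Γ'} {Δ Δ'} → Env s Δ Δ' → SubHyps s Δ Δ'
  Env⇒SubHyps {s = s} env {X} p = mr⇒truth (proj₂ (shape X)) s _ (proj₂ (env p (proj₂ (shape X))))

  mr-wkP : ∀ P {Γ Γ' Δ} {A : Fm Γ} {R} (sh : Shape A R) (s : Sub Γ Γ') (a : Tms Γ' (flat R)) →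
           Γ' ⨾ Δ ⊢ mr sh s a → P ⊕ Γ' ⨾ wkHs P Δ ⊢ mr sh (wks P s) (renTs (flat R) (wkP P) a)
  mr-wkP P sh s a d = cast (subF-wkP-mr P sh s a) (⊢-wkP P d)

  mr-renF : ∀ {Γ Γ' Δ} {A : Fm Γ} {R} (r : Ren Γ Γ') (x : Shape A R) (x' : Shape (renF r A) R) (s : Sub Γ' Δ) (a : Tms Δ (flat R)) →
            mr x' s a ≡ mr x (s ⊙ renSub r) a
  mr-renF {A = A} r x x' s a = trans (mr-irrelevant x' (Shape-subF x (renSub r)) (renF≡subF r A) s a) (mr-Shape-subF x (renSub r) s a)

  mr-ExFree-Ax : ∀ {Γ Γ' Δ'} {A : Fm Γ} → ExFree A → Ax A → (s : Sub Γ Γ') → ∀ {R} (sh : Shape A R) → Realized Δ' sh s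
  mr-ExFree-Ax ef a s sh = defaults _ , ExFree⇒mr ef sh s _ (ax (Ax-subF s a))

  -- flat (rimp rnil a) is mapTys (nil ⇛_) (flat a), which agrees with flat a only componentwise.
  dropNil : ∀ P {Γ σ} → Tms Γ (mapTys (one σ ⇛_) (mapTys (nil ⇛_) P)) → Tms Γ (mapTys (one σ ⇛_) P)
  dropNil nil        _       = tt
  dropNil (one τ)    f       = f
  dropNil (pair a b) (f , g) = dropNil a f , dropNil b g

  dropNil-app : ∀ P {Γ σ} (h : Tms Γ (mapTys (one σ ⇛_) (mapTys (nil ⇛_) P))) (u : Tm Γ σ) →
                appM nil P (appM (one σ) (mapTys (nil ⇛_) P) h u) tt ≡ appM (one σ) P (dropNil P h) u
  dropNil-app nil        h       u = refl
  dropNil-app (one τ)    h       u = refl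
  dropNil-app (pair a b) (h , g) u = cong₂ _,_ (dropNil-app a h u) (dropNil-app b g u)

  dropNil-renTs : ∀ P {Γ Δ σ} (r : Ren Γ Δ) (h : Tms Γ (mapTys (one σ ⇛_) (mapTys (nil ⇛_) P))) →
                  renTs (mapTys (one σ ⇛_) P) r (dropNil P h) ≡ dropNil P (renTs _ r h)
  dropNil-renTs nil        r h       = refl
  dropNil-renTs (one τ)    r h       = refl
  dropNil-renTs (pair a b) r (h , g) = cong₂ _,_ (dropNil-renTs a r h) (dropNil-renTs b r g)

  wks-nil : ∀ {Γ Γ'} (s : Sub Γ Γ') → wks nil s ≗s s
  wks-nil s z = trans (renT≡subT _ (s z)) (subT-id (s z))

  mr-∀∈⇒∀ : ∀ {Γ Γ' Δ' σ} {t : Tm Γ (σ *)} {A : Fm (σ ∷ Γ)} {a} (x₁ x₂ : Shape A a) (s : Sub Γ Γ') →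
            Γ' ⨾ Δ' ⊢ subF s (∀∈ t A ⇒' ∀' σ (var here ∈' wkT t ⇒' A)) →
            Realized Δ' (s⇒ (s∀∈ {t = t} x₁) (s∀ (s⇒ (s∈ {t = var here} {u = wkT t}) x₂))) s
  mr-∀∈⇒∀ {σ = σ} {t} {A} {a} x₁ x₂ s true = ΛM P _ c ,
    mr-⇒I (s∀∈ {t = t} x₁) (s∀ (s⇒ mem x₂)) s c true
      (mr-∀I (s⇒ mem x₂) s₁ (ΛM nil P a') (mr-⇒I mem x₂ (liftS s₁) a' truth realized))
    where
      mem : Shape (var here ∈' wkT t) rnil
      mem = s∈
      P = flat a
      s₁ = wks P s
      a' = renTs P there (vars P)
      c = ΛM (one σ) (mapTys (nil ⇛_) P) (ΛM nil P a')
      hyp-∀∈ = ∀-open (∀∈-unfold (mr⇒truth (s∀∈ {t = t} x₁) s₁ _ hyp₀))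
      truth = cast (cong (λ z → (var here ∈' z) ⇒' subF (liftS s₁) A) (sym (subT-liftS-wkT s₁ t))) hyp-∀∈
      member = cast (cong (var here ∈'_) (trans (subT-cong (wks-nil (liftS s₁)) (wkT t)) (subT-liftS-wkT s₁ t))) hyp₀
      realized = cast (trans (mr-irrelevant x₁ x₂ refl _ _) (mr-cong x₂ (λ z → sym (wks-nil (liftS s₁) z)) _))
                      (⇒E (⊢-wk₁ (∀-open (∀∈-unfold hyp₀))) member)

  -- A realizer of ∀x∈t A is uniform in x, so it is taken to be the union of the f x over x ∈ t.
  mr-∀⇒∀∈ : ∀ {Γ Γ' Δ' σ} {t : Tm Γ (σ *)} {A : Fm (σ ∷ Γ)} {a} (x₃ x₄ : Shape A a) (s : Sub Γ Γ') →
            Γ' ⨾ Δ' ⊢ subF s (∀' σ (var here ∈' wkT t ⇒' A) ⇒' ∀∈ t A) →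
            Realized Δ' (s⇒ (s∀ (s⇒ (s∈ {t = var here} {u = wkT t}) x₃)) (s∀∈ {t = t} x₄)) s
  mr-∀⇒∀∈ {σ = σ} {t} {a = a} x₃ x₄ s true = ΛM Q P c , mr-⇒I (s∀ (s⇒ mem x₃)) (s∀∈ {t = t} x₄) s c true
    (∀∈I (cast (mr-irrelevant x₃ x₄ refl _ _) (mr-mono x₃ _ _ _ bounded applied)))
    where
      mem : Shape (var here ∈' wkT t) rnil
      mem = s∈
      P = flat a
      Q = mapTys (one σ ⇛_) (mapTys (nil ⇛_) P)
      s₂ = wks Q s
      f = vars Q
      c = bigUnionᵖ P (AllSetValued-flat a) (subT s₂ t) (dropNil P f)
      fx = appM (one σ) (mapTys (nil ⇛_) P) (renTs _ there f) (var here)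
      applied = mr-⇒E mem x₃ (liftS s₂) fx tt (⊢-wk₁ (∀-open hyp₀)) (cast (cong (var here ∈'_) (sym (subT-liftS-wkT s₂ t))) hyp₀)
      bounded = cast (cong (λ z → z ⊑[ P ] renTs P there c)
                           (trans (cong (λ g → appM (one σ) P g (var here)) (dropNil-renTs P there f)) (sym (dropNil-app P _ (var here)))))
                     (⊑ᵖ-bigUnionᵖ P (AllSetValued-flat a) (subT s₂ t) (dropNil P f) hyp₀)

  mr-∃∈⇒∃ : ∀ {Γ Γ' Δ' σ} {t : Tm Γ (σ *)} {A : Fm (σ ∷ Γ)} {a} (x₁ x₂ : Shape A a) (s : Sub Γ Γ') →
            Γ' ⨾ Δ' ⊢ subF s (∃∈ t A ⇒' ∃' σ (var here ∈' wkT t ∧' A)) →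
            Realized Δ' (s⇒ (s∃∈ {t = t} x₁) (s∃ (s∧ (s∈ {t = var here} {u = wkT t}) x₂))) s
  mr-∃∈⇒∃ {t = t} {a = a} x₁ x₂ s true = ΛM P _ c , mr-⇒I (s∃∈ {t = t} x₁) (s∃ (s∧ mem x₂)) s c true
    (∃∈-map hyp₀ (∧I (cast (cong (var here ∈'_) (sym (subT-liftS-wkT s₁ t))) hyp₁) (cast (mr-irrelevant x₁ x₂ refl _ _) hyp₀)))
    where
      mem : Shape (var here ∈' wkT t) rnil
      mem = s∈
      P = flat a
      s₁ = wks P s
      c = subT s₁ t , tt , vars P

  mr-∃⇒∃∈ : ∀ {Γ Γ' Δ' σ} {t : Tm Γ (σ *)} {A : Fm (σ ∷ Γ)} {a} (x₃ x₄ : Shape A a) (s : Sub Γ Γ') →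
            Γ' ⨾ Δ' ⊢ subF s (∃' σ (var here ∈' wkT t ∧' A) ⇒' ∃∈ t A) →
            Realized Δ' (s⇒ (s∃ (s∧ (s∈ {t = var here} {u = wkT t}) x₃)) (s∃∈ {t = t} x₄)) s
  mr-∃⇒∃∈ {σ = σ} {t} {a = a} x₃ x₄ s true = ΛM Q P c , mr-⇒I (s∃ (s∧ mem x₃)) (s∃∈ {t = t} x₄) s c true
    (∃∈E hyp₀ (∃∈-var (cast (cong (var here ∈'_) (subT-liftS-wkT (wks Q s) t)) (∧E₁ hyp₀))
                      (cast (mr-irrelevant x₃ x₄ refl _ _) (∧E₂ hyp₀))))
    where
      mem : Shape (var here ∈' wkT t) rnil
      mem = s∈
      P = flat a
      Q = pair (one (σ *)) (pair nil P)
      c = proj₂ (proj₂ (vars Q))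

  mr-AC : ∀ {Γ Γ' Δ' ρ σ} (A : Fm (σ ∷ ρ ∷ Γ)) {a} (x : Shape A a) (x' : Shape (renF (liftR (liftR (there {τ = ρ ⇒ σ *}))) A) a)
          (s : Sub Γ Γ') → Realized Δ' (s⇒ (s∀ (s∃ x)) (s∃ (s∀ (s∃∈ {t = var (there here) · var here} x')))) s
  mr-AC {ρ = ρ} {σ} A {a} x x' s =
    ΛM P _ c , mr-⇒I (s∀ (s∃ x)) (s∃ (s∀ (s∃∈ {t = var (there here) · var here} x'))) s c (ax (Ax-subF s (AC A)))
    (mr-sng (s∀ (s∃∈ {t = var (there here) · var here} x')) s₁ g h (∀I (cast (cong (∃∈ _) (sym same-body)) (∀-open hyp₀))))
    where
      P = flat (rall ρ (rex σ a))
      s₁ = wks P s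
      g = proj₁ (vars P)
      h = proj₂ (vars P)
      c = con (sng (ρ ⇒ σ *)) · g , h
      lifted : liftS (liftS (ext g s₁)) ⊙ renSub (liftR (liftR there)) ≗s liftS (liftS s₁)
      lifted here              = refl
      lifted (there here)      = refl
      lifted (there (there z)) = refl
      same-body = trans (mr-renF _ x x' _ _) (mr-cong x lifted _)

  -- B is ∃-free, so the default tuple realizes it; feeding that to the realizer of B ⇒ ∃y A
  -- produces a witness set that does not depend on any realizer of B.
  mr-IP : ∀ {Γ Γ' Δ' σ} (B : Fm Γ) (A : Fm (σ ∷ Γ)) (ef : ExFree B) {rb ra} (xb : Shape B rb) (xb' : Shape (wkF {σ = σ *} B) rb)
          (xa : Shape A ra) (xa' : Shape (renF (liftR (there {τ = σ *})) A) ra) (s : Sub Γ Γ') →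
          Realized Δ' (s⇒ (s⇒ xb (s∃ xa)) (s∃ (s⇒ xb' (s∃∈ {t = var here} xa')))) s
  mr-IP {Γ} {σ = σ} B A ef {rb} {ra} xb xb' xa xa' s =
    ΛM P _ c , mr-⇒I (s⇒ xb (s∃ xa)) (s∃ (s⇒ xb' (s∃∈ {t = var here} xa'))) s c (ax (Ax-subF s (IP B A ef)))
    (mr-sng (s⇒ xb' (s∃∈ {t = var here} xa')) s₁ w₀ (ΛM Pb Pa a₀') (mr-⇒I xb' (s∃∈ {t = var here} xa') s₂ a₀' true realized))
    where
      Pb = flat rb
      Pa = flat ra
      P = flat (rimp rb (rex σ ra))
      g₁ = proj₁ (vars P)
      g₂ = proj₂ (vars P)
      s₁ = wks P s
      d = defaults Pb
      w₀ = app Pb g₁ d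
      a₀' = renTs Pa (wkP Pb) (appM Pb Pa g₂ d)
      c = con (sng (σ *)) · w₀ , ΛM Pb Pa a₀'
      s₂ = ext w₀ s₁
      body-lift : ∀ {Θ} (s' : Sub (σ * ∷ Γ) Θ) → liftS {σ = σ} s' ⊙ renSub (liftR there) ≗s liftS (s' ∘ there)
      body-lift s' here      = refl
      body-lift s' (there z) = refl
      at-default = mr-⇒E xb (s∃ xa) s₁ (vars P) d hyp₁ (ExFree⇒mr ef xb s₁ d (cast (subF-renF there s₂ B) hyp₀))
      true = ⇒I (cast (cong (∃∈ w₀) (sym (trans (subF-renF (liftR there) (liftS s₂) A) (subF-cong (body-lift s₂) A))))
                      (∃∈-map at-default (mr⇒truth xa _ _ hyp₀)))
      premise-wk = ⊢-wk₁ (mr-wkP Pb (s⇒ xb (s∃ xa)) s₁ (vars P) hyp₀)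
      B-true = cast (subF-renF there (wks Pb s₂) B) (mr⇒truth xb' (wks Pb s₂) _ hyp₀)
      applied = mr-⇒E xb (s∃ xa) (wks Pb s₁) _ (renTs Pb (wkP Pb) d) premise-wk (ExFree⇒mr ef xb _ _ B-true)
      realized = cast (cong₂ ∃∈ (sym (renT-app Pb (wkP Pb) g₁ d))
        (trans (cong (λ z → mr xa (liftS (wks Pb s₁)) (renTs Pa there z)) (sym (renTs-appM Pb Pa (wkP Pb) g₂ d)))
               (sym (trans (mr-renF _ xa xa' _ _) (mr-cong xa (body-lift _) _))))) applied

  mr-Ax : ∀ {Γ Γ' Δ'} {A : Fm Γ} → Ax A → (s : Sub Γ Γ') → ∀ {R} (sh : Shape A R) → Realized Δ' sh s
  mr-Ax a@(eq-refl t)            s = mr-ExFree-Ax (ef-at (at-≐ t t)) a s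
  mr-Ax a@(eq-subst u t A at)    s =
    mr-ExFree-Ax (ef-⇒ (ef-∧ (ef-at (at-≐ u t)) (ef-at (Atomic-subF (single u) at))) (ef-at (Atomic-subF (single t) at))) a s
  mr-Ax a@(Σ-ax x y z)           s = mr-ExFree-Ax (ef-at (at-≐ _ _)) a s
  mr-Ax a@(Π-ax x y)             s = mr-ExFree-Ax (ef-at (at-≐ _ _)) a s
  mr-Ax a@(sng-ax w x)           s =
    mr-ExFree-Ax (ef-∧ (ef-⇒ (ef-at (at-∈ _ _)) (ef-at (at-≐ _ _))) (ef-⇒ (ef-at (at-≐ _ _)) (ef-at (at-∈ _ _)))) a s
  mr-Ax a@(cup-ax w x y)         s =
    mr-ExFree-Ax (ef-∧ (ef-⇒ (ef-at (at-∈ _ _)) (ef-∨ (ef-at (at-∈ _ _)) (ef-at (at-∈ _ _))))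
                       (ef-⇒ (ef-∨ (ef-at (at-∈ _ _)) (ef-at (at-∈ _ _))) (ef-at (at-∈ _ _)))) a s
  mr-Ax a@(bigcup-mem z x w y)   s = mr-ExFree-Ax (ef-⇒ (ef-∧ (ef-at (at-∈ _ _)) (ef-at (at-∈ _ _))) (ef-at (at-∈ _ _))) a s
  mr-Ax a@(bigcup-sng x y)       s = mr-ExFree-Ax (ef-at (at-≐ _ _)) a s
  mr-Ax a@(bigcup-cup x y z)     s = mr-ExFree-Ax (ef-at (at-≐ _ _)) a s
  mr-Ax (∀∈-def t A) s (s∧ (s⇒ (s∀∈ x₁) (s∀ (s⇒ s∈ x₂))) (s⇒ (s∀ (s⇒ s∈ x₃)) (s∀∈ x₄)))
    with Shape-det x₁ x₂ | Shape-det x₁ x₃ | Shape-det x₁ x₄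
  ... | refl | refl | refl =
    let (r₁ , d₁) = mr-∀∈⇒∀ {t = t} x₁ x₂ s (∧E₁ def)
        (r₂ , d₂) = mr-∀⇒∀∈ {t = t} x₃ x₄ s (∧E₂ def)
    in (r₁ , r₂) , ∧I d₁ d₂
    where def = ax (Ax-subF s (∀∈-def t A))
  mr-Ax (∃∈-def t A) s (s∧ (s⇒ (s∃∈ x₁) (s∃ (s∧ s∈ x₂))) (s⇒ (s∃ (s∧ s∈ x₃)) (s∃∈ x₄)))
    with Shape-det x₁ x₂ | Shape-det x₁ x₃ | Shape-det x₁ x₄
  ... | refl | refl | refl =
    let (r₁ , d₁) = mr-∃∈⇒∃ {t = t} x₁ x₂ s (∧E₁ def)
        (r₂ , d₂) = mr-∃⇒∃∈ {t = t} x₃ x₄ s (∧E₂ def)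
    in (r₁ , r₂) , ∧I d₁ d₂
    where def = ax (Ax-subF s (∃∈-def t A))
  mr-Ax (AC A) s (s⇒ (s∀ (s∃ x)) (s∃ (s∀ (s∃∈ x')))) with Shape-det x (Shape-unrenF A _ x')
  ... | refl = mr-AC A x x' s
  mr-Ax (IP B A ef) s (s⇒ (s⇒ xb (s∃ xa)) (s∃ (s⇒ xb' (s∃∈ xa'))))
    with Shape-det xb (Shape-unrenF B there xb') | Shape-det xa (Shape-unrenF A _ xa')
  ... | refl | refl = mr-IP B A ef xb xb' xa xa' s

  -- Closed terms of set type denote finite sets (Tait-style reducibility)

  data SetTree (Γ : Ctx) (σ : Ty) : Set where
    leaf : Tm Γ σ → SetTree Γ σ
    node : SetTree Γ σ → SetTree Γ σ → SetTree Γ σ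

  ⟦_⟧ : ∀ {Γ σ} → SetTree Γ σ → Tm Γ (σ *)
  ⟦ leaf u ⟧   = con (sng _) · u
  ⟦ node l r ⟧ = con (cup _) · ⟦ l ⟧ · ⟦ r ⟧

  AllLeaves : ∀ {Γ σ} → (Tm Γ σ → Set) → SetTree Γ σ → Set
  AllLeaves P (leaf u)   = P u
  AllLeaves P (node l r) = AllLeaves P l × AllLeaves P r

  leaves : ∀ {Γ σ} → SetTree Γ σ → Σ ℕ λ n → Vec (Tm Γ σ) (suc n)
  leaves (leaf u)   = 0 , u ∷ Vec.[]
  leaves (node l r) = proj₁ (leaves l) + suc (proj₁ (leaves r)) , proj₂ (leaves l) Vec.++ proj₂ (leaves r)

  Reducible : ∀ τ → Tm [] τ → Set
  Reducible G       t = ⊤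
  Reducible (σ ⇒ τ) t = ∀ u → Reducible σ u → Reducible τ (t · u)
  Reducible (σ *)   t = Σ (SetTree [] σ) λ tr → [] ⨾ [] ⊢ t ≐ ⟦ tr ⟧ × AllLeaves (Reducible σ) tr

  Reducible-≐ : ∀ τ {t t' : Tm [] τ} → Reducible τ t' → [] ⨾ [] ⊢ t ≐ t' → Reducible τ t
  Reducible-≐ G       r              e = tt
  Reducible-≐ (σ ⇒ τ) r              e = λ u ru → Reducible-≐ τ (r u ru) (·-congˡ u e)
  Reducible-≐ (σ *)   (tr , e' , rs) e = tr , ≐-trans e e' , rs

  Reducible-funTy : ∀ n (t : Tm [] (funTy n)) → Reducible (funTy n) t
  Reducible-funTy zero    t = tt
  Reducible-funTy (suc n) t = λ u _ → Reducible-funTy n (t · u)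

  Reducible-∪ : ∀ {σ} {x y : Tm [] (σ *)} → Reducible (σ *) x → Reducible (σ *) y → Reducible (σ *) (con (cup σ) · x · y)
  Reducible-∪ (tx , ex , rx) (ty , ey , ry) = node tx ty , ·-cong (·-congʳ (con (cup _)) ex) ey , (rx , ry)

  Reducible-⋃ : ∀ {σ τ} (tr : SetTree [] σ) → AllLeaves (Reducible σ) tr → (y : Tm [] (σ ⇒ τ *)) → Reducible (σ ⇒ τ *) y →
                Reducible (τ *) (con (bigcup σ τ) · ⟦ tr ⟧ · y)
  Reducible-⋃ (leaf u)   ru        y ry = Reducible-≐ _ (ry u ru) (ax (bigcup-sng u y))
  Reducible-⋃ (node l r) (rl , rr) y ry = Reducible-≐ _ (Reducible-∪ (Reducible-⋃ l rl y ry) (Reducible-⋃ r rr y ry)) (ax (bigcup-cup _ _ y))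

  reducible-con : ∀ {τ} (c : Const τ) → Reducible τ (con c)
  reducible-con (fun f)      = Reducible-funTy (funAr f) (con (fun f))
  reducible-con (Πc σ τ)     = λ x rx y ry → Reducible-≐ σ rx (ax (Π-ax x y))
  reducible-con (Σc ρ σ τ)   = λ x rx y ry z rz → Reducible-≐ τ (rx z rz (y · z) (ry z rz)) (ax (Σ-ax x y z))
  reducible-con (sng σ)      = λ x rx → leaf x , ≐-refl _ , rx
  reducible-con (cup σ)      = λ x rx y ry → Reducible-∪ rx ry
  reducible-con (bigcup σ τ) = λ { x (tr , e , rs) y ry → Reducible-≐ (τ *) (Reducible-⋃ tr rs y ry) (·-congˡ y (·-congʳ _ e)) }

  reducible : ∀ {τ} (t : Tm [] τ) → Reducible τ t
  reducible (var ())
  reducible (con c) = reducible-con c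
  reducible (t · u) = reducible t u (reducible u)

  bigOr-++⁺ˡ : ∀ {Γ Δ m n} (xs : Vec (Fm Γ) (suc m)) (ys : Vec (Fm Γ) (suc n)) → Γ ⨾ Δ ⊢ bigOr xs → Γ ⨾ Δ ⊢ bigOr (xs Vec.++ ys)
  bigOr-++⁺ˡ (x ∷ Vec.[])    (y ∷ ys) d = ∨I₁ d
  bigOr-++⁺ˡ (x ∷ x' ∷ xs) ys       d = ∨E d (∨I₁ hyp₀) (∨I₂ (bigOr-++⁺ˡ (x' ∷ xs) ys hyp₀))

  bigOr-++⁺ʳ : ∀ {Γ Δ m n} (xs : Vec (Fm Γ) (suc m)) (ys : Vec (Fm Γ) (suc n)) → Γ ⨾ Δ ⊢ bigOr ys → Γ ⨾ Δ ⊢ bigOr (xs Vec.++ ys)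
  bigOr-++⁺ʳ (x ∷ Vec.[])    (y ∷ ys) d = ∨I₂ d
  bigOr-++⁺ʳ (x ∷ x' ∷ xs) ys       d = ∨I₂ (bigOr-++⁺ʳ (x' ∷ xs) ys d)

  liftR-there-[wkT] : ∀ {Γ σ} (A : Fm (σ ∷ Γ)) (u : Tm Γ σ) → renF (liftR there) A [ wkT {σ = σ} u ] ≡ wkF (A [ u ])
  liftR-there-[wkT] A u = trans (cong (_[ wkT u ]) (renF≡subF _ A)) (trans (subF²-cong _ _ (renSub there) (single u) pointwise A) (sym (wkF≡subF _)))
    where
      pointwise : single (wkT u) ⊙ renSub (liftR there) ≗s renSub there ⊙ single u
      pointwise here      = renT≡subT there u
      pointwise (there x) = refl

  ∃∈-tree⇒bigOr : ∀ {Γ Δ σ} (A : Fm (σ ∷ Γ)) (tr : SetTree Γ σ) →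
                  Γ ⨾ Δ ⊢ ∃∈ ⟦ tr ⟧ A → Γ ⨾ Δ ⊢ bigOr (Vec.map (A [_]) (proj₂ (leaves tr)))
  ∃∈-tree⇒bigOr A (leaf u) d = ∃∈E d (cast (liftR-there-[wkT] A u) (leibniz (renF (liftR there) A) is-u (cast (sym (liftR-there-[var] A)) hyp₀)))
    where
      is-u = ⇒E (∧E₁ (ax (sng-ax (var here) (wkT u)))) hyp₁
  ∃∈-tree⇒bigOr {Γ} {Δ} A (node l r) d = ∨E split
    (cast (cong bigOr (sym (map-++ (A [_]) xs ys))) (bigOr-++⁺ˡ (Vec.map (A [_]) xs) (Vec.map (A [_]) ys) (∃∈-tree⇒bigOr A l hyp₀)))
    (cast (cong bigOr (sym (map-++ (A [_]) xs ys))) (bigOr-++⁺ʳ (Vec.map (A [_]) xs) (Vec.map (A [_]) ys) (∃∈-tree⇒bigOr A r hyp₀)))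
    where
      xs = proj₂ (leaves l)
      ys = proj₂ (leaves r)
      split : Γ ⨾ Δ ⊢ ∃∈ ⟦ l ⟧ A ∨' ∃∈ ⟦ r ⟧ A
      split = ∃∈E d (∨E (⇒E (∧E₁ (ax (cup-ax (var here) (wkT ⟦ l ⟧) (wkT ⟦ r ⟧)))) hyp₁)
                        (∨I₁ (∃∈-var hyp₀ hyp₁)) (∨I₂ (∃∈-var hyp₀ hyp₁)))

  ∃∈-≐ : ∀ {Γ Δ σ} {A : Fm (σ ∷ Γ)} {w w' : Tm Γ (σ *)} → Γ ⨾ Δ ⊢ w ≐ w' → Γ ⨾ Δ ⊢ ∃∈ w A → Γ ⨾ Δ ⊢ ∃∈ w' A
  ∃∈-≐ e d = ∃∈E d (∃∈-var (∈-congʳ (⊢-wk₁ (⊢-wk₁ (⊢-wk e))) hyp₁) hyp₀)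

  -- Soundness

  mr-inst : ∀ {Γ Γ' σ} {A : Fm (σ ∷ Γ)} {R} (x : Shape A R) (t : Tm Γ σ) (sh : Shape (A [ t ]) R) (s : Sub Γ Γ') (a : Tms Γ' (flat R)) →
            mr sh s a ≡ mr x (ext (subT s t) s) a
  mr-inst x t sh s a = trans (mr-irrelevant sh (Shape-subF x (single t)) refl s a) (trans (mr-Shape-subF x (single t) s a) (mr-cong x pointwise a))
    where
      pointwise : s ⊙ single t ≗s ext (subT s t) s
      pointwise here      = refl
      pointwise (there z) = refl

  -- The realizers c(x), x ∈ w, are merged into one by a big union; monotonicity of mr transfers c(x) to it.
  mr-∃E : ∀ {Γ Γ' Δ' σ} {C : Fm Γ} {R} (sh : Shape C R) (s : Sub Γ Γ') (w : Tm Γ' (σ *)) (c : Tms (σ ∷ Γ') (flat R)) {X} →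
          Γ' ⨾ Δ' ⊢ ∃∈ w X → σ ∷ Γ' ⨾ X ∷ var here ∈' wkT w ∷ lmap wkF Δ' ⊢ mr sh (wks (one σ) s) c →
          Γ' ⨾ Δ' ⊢ mr sh s (bigUnionᵖ (flat R) (AllSetValued-flat R) w (ΛM (one σ) (flat R) c))
  mr-∃E {σ = σ} {R = R} sh s w c dw dc =
    ∃∈E dw (cast (sym (trans (wkF≡subF _) (subF-wkP-mr (one σ) sh s _)))
                 (mr-mono sh _ _ _ bounded (mr-≐ sh _ c _ (ΛM-β-vars (one σ) (flat R) c) dc)))
    where
      bounded = ⊑ᵖ-bigUnionᵖ (flat R) (AllSetValued-flat R) w (ΛM (one σ) (flat R) c) hyp₁

  Shape-wkF : ∀ {Γ τ} {C : Fm Γ} {R} → Shape C R → Shape (wkF {σ = τ} C) R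
  Shape-wkF {C = C} {R} sh = subst (λ X → Shape X R) (sym (wkF≡subF C)) (Shape-subF sh (renSub there))

  module _ (T-ExFree : ∀ B → T B → ExFree B) where

    mr-soundness : ∀ {Γ Δ A} → Γ ⨾ Δ ⊢ A → ∀ {Γ' Δ'} (s : Sub Γ Γ') → Env s Δ Δ' → ∀ {R} (sh : Shape A R) → Realized Δ' sh s
    mr-soundness (hyp p)         s env sh = env p sh
    mr-soundness (ax a)          s env sh = mr-Ax a s sh
    mr-soundness (thy {B = B} b) s env sh =
      defaults _ , ExFree⇒mr (ExFree-renF (T-ExFree B b)) sh s _ (cast (sym (subF-closed s B)) (thy b))
      where
        ExFree-renF : ∀ {B} → ExFree B → ExFree (renF emptyR B)
        ExFree-renF {B} ef = subst ExFree (sym (renF≡subF emptyR B)) (ExFree-subF (renSub emptyR) ef)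
    mr-soundness (⊥E d)          s env sh = defaults _ , ⊥E (proj₂ (mr-soundness d s env s⊥))
    mr-soundness (∧I d e)        s env (s∧ x y) = Realized-∧ (mr-soundness d s env x) (mr-soundness e s env y)
    mr-soundness (∧E₁ {B = B} d) s env sh =
      let ((a , _) , dab) = mr-soundness d s env (s∧ sh (proj₂ (shape B))) in a , ∧E₁ dab
    mr-soundness (∧E₂ {A = A} d) s env sh =
      let ((_ , b) , dab) = mr-soundness d s env (s∧ (proj₂ (shape A)) sh) in b , ∧E₂ dab
    mr-soundness (∨I₁ d)         s env (s∨ x y) = let (a , da) = mr-soundness d s env x in (a , defaults _) , ∨I₁ da
    mr-soundness (∨I₂ d)         s env (s∨ x y) = let (b , db) = mr-soundness d s env y in (defaults _ , b) , ∨I₂ db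
    mr-soundness (∨E {A = A} {B = B} d e f) s env {R} sh =
      let xa = proj₂ (shape A) ; xb = proj₂ (shape B)
          ((a , b) , dab) = mr-soundness d s env (s∨ xa xb)
          (c₁ , dc₁) = mr-soundness e s (Env-∷ xa a env) sh
          (c₂ , dc₂) = mr-soundness f s (Env-∷ xb b env) sh
          ok = AllSetValued-flat R
      in unionᵖ _ ok c₁ c₂ ,
         ∨E dab (mr-mono sh s c₁ _ (⊑ᵖ-unionˡ _ ok c₁ c₂) dc₁) (mr-mono sh s c₂ _ (⊑ᵖ-unionʳ _ ok c₁ c₂) dc₂)
    mr-soundness (⇒I d)          s env (s⇒ {a = ra} {b = rb} x y) =
      let (c , dc) = mr-soundness d (wks (flat ra) s) (Env-∷ x (vars (flat ra)) (Env-wks (flat ra) env)) y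
      in ΛM (flat ra) (flat rb) c , mr-⇒I x y s c (⊢-sub (⇒I d) s (Env⇒SubHyps env)) dc
    mr-soundness (⇒E {A = A} d e) s env sh =
      let xa = proj₂ (shape A) ; (f , df) = mr-soundness d s env (s⇒ xa sh) ; (a , da) = mr-soundness e s env xa
      in appM _ _ f a , mr-⇒E xa sh s f a df da
    mr-soundness (∀I {σ = σ} d)  s env (s∀ {a = ra} x) =
      let (c , dc) = mr-soundness d (liftS s) (Env-liftS env) x in ΛM (one σ) (flat ra) c , mr-∀I x s c dc
    mr-soundness (∀E {σ = σ} {A = A} d t) s env {R} sh =
      let xa = Shape-unsubF A (single t) sh ; (f , df) = mr-soundness d s env (s∀ xa)
      in appM (one σ) (flat R) f (subT s t) , cast (sym (mr-inst xa t sh s _)) (mr-∀E xa s f (subT s t) df)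
    mr-soundness (∃I {σ = σ} {A = A} t d) s env (s∃ x) =
      let sh = Shape-subF x (single t) ; (a , da) = mr-soundness d s env sh
      in (con (sng σ) · subT s t , a) , mr-sng x s (subT s t) a (cast (mr-inst x t sh s a) da)
    mr-soundness (∃E {A = A} {C = C} d e) s env {R} sh =
      let xa = proj₂ (shape A) ; ((w , a) , dwa) = mr-soundness d s env (s∃ xa)
          (c , dc) = mr-soundness e (liftS s) (Env-∷ xa (renTs _ there a) (Env-wk₁ (Env-liftS env))) (Shape-wkF sh)
      in _ , mr-∃E sh s w c dwa (cast (mr-renF there sh (Shape-wkF sh) (liftS s) c) dc)

    herbrand-disjunction : (σ : Ty) (A : Fm (σ ∷ [])) → [] ⨾ [] ⊢ ∃' σ A →
                           ∃ λ n → Σ (Vec (Tm [] σ) (suc n)) λ ts → [] ⨾ [] ⊢ bigOr (Vec.map (A [_]) ts)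
    herbrand-disjunction σ A d =
      let x = proj₂ (shape A)
          ((w , _) , realized) = mr-soundness d var (λ ()) (s∃ x)
          (tr , w≐tr , _) = reducible w
          bounded = cast (cong (∃∈ w) (subF-liftS-var A)) (∃∈-map realized (mr⇒truth x _ _ hyp₀))
      in proj₁ (leaves tr) , proj₂ (leaves tr) , ∃∈-tree⇒bigOr A tr (∃∈-≐ w≐tr bounded)

corollary3 : (𝓛 : Language) → let open Logic 𝓛 in
    (T : Fm [] → Set) → (∀ B → T B → ExFree B) →
    (σ : Ty) (A : Fm (σ ∷ [])) →
    Der T [] [] (∃' σ A) →
    ∃ λ n → Σ (Vec (Tm [] σ) (suc n)) λ ts →
      Der T [] [] (bigOr (map (λ t → A [ t ]) ts))
corollary3 𝓛 T T-ExFree = Realizability.herbrand-disjunction 𝓛 T T-ExFree
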